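{- If a formula occurrence $A=A_1\,\alpha\,A_2$ in a MALL$^\ast$ sequent $\Gamma,A$ separates a proof net $\theta$ of $\Gamma,A$ for which $G(\theta)$ is connected, then there is at most one instance $\sigma$ of an $\alpha$-rule that could generate $A$ in the last step of a proof $\Pi$ of $\Gamma,A$ with proof net $\theta$.
   Context: Setting: MALL$^\ast$ (MALL with connectives $\otimes$, par ($⅋$), $\&$, $\oplus$, plus cut formulas $A\ast A^\perp$ kept in sequents; the cut rule derives $\Gamma,A\ast A^\perp,\Delta$ from $\Gamma,A$ and $A^\perp,\Delta$; the $\&$-rule derives $\Omega_1,\Omega_2,\Gamma,A\&B$ from $\Omega_1,\Gamma,A$ and $\Omega_2,\Gamma,B$ with $\Omega_i$ cut-only). The proof net of $\Pi$ is $\theta_\Pi=\{\lambda_R\}$ over $\&$-resolutions $R$ (delete one branch above each $\&$-rule; $\lambda_R$ is the set of links between leaves given by the axioms of $R$). For a linking set $\Lambda$ on $\Gamma$: $\Gamma{\restriction}\Lambda$ deletes all vertices not below a leaf occurring in a link of $\Lambda$; a $\&$-vertex $w$ is toggled by $\Lambda$ if both its arguments occur in $\Gamma{\restriction}\Lambda$; a link $a$ depends on $w$ if some $\lambda,\lambda'\in\Lambda$ have $a\in\lambda$, $a\notin\lambda'$ and $w$ is the only $\&$ toggled by $\{\lambda,\lambda'\}$. $G(\Lambda)$ is $\Gamma{\restriction}\Lambda$ plus all link edges plus jump edges from the leaves of each link to each $\&$-vertex it depends on. $A=A_1\alpha A_2$ separates $\theta$ if (i) $\alpha$ is par or $\&$,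 (ii) $\alpha=\oplus$ and one $A_i$ is absent from $G(\theta)$, or (iii) $\alpha\in\{\otimes,\ast\}$ and $G(\theta)$ has no cycle through $\alpha$. -}

module Defs where

open import Data.Nat using (ℕ; _≤_)
open import Data.List using (List; []; _∷_; _++_; map; length)
open import Data.List.Membership.Propositional using (_∈_)
open import Data.List.Relation.Ternary.Interleaving.Propositional using (Interleaving; consˡ; consʳ)
open import Data.List.Relation.Unary.Linked using (Linked)
open import Data.List.Relation.Unary.Unique.Propositional using (Unique)
open import Data.Product using (Σ; _×_; _,_; proj₁; proj₂)
open import Data.Sum using (_⊎_; inj₁; inj₂)
open import Data.Unit using (⊤)
open import Data.Empty using (⊥)
open import Data.Maybe using (Maybe; just; nothing)
open import Relation.Nullary using (¬_)
open import Relation.Binary.PropositionalEquality using (_≡_)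
open import Relation.Binary.Construct.Closure.ReflexiveTransitive using (Star)

data Conn : Set where
  tens parr wth plus : Conn

data Formula : Set where
  pos neg : ℕ → Formula
  bin     : Conn → Formula → Formula → Formula

dualC : Conn → Conn
dualC tens = parr
dualC parr = tens
dualC wth  = plus
dualC plus = wth

dual : Formula → Formula
dual (pos n)     = neg n
dual (neg n)     = pos n
dual (bin c A B) = bin (dualC c) (dual A) (dual B)

data Item : Set where
  frm : Formula → Item
  cut : Formula → Item      -- cut A  stands for  A ∗ A^⊥

IsCut : Item → Set
IsCut (frm _) = ⊥
IsCut (cut _) = ⊤

data Pos : Formula → Set where
  here  : ∀ {A} → Pos A
  left  : ∀ {c A B} → Pos A → Pos (bin c A B)
  right : ∀ {c A B} → Pos B → Pos (bin c A B)

data IPos : Item → Set where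
  frmP    : ∀ {A} → Pos A → IPos (frm A)
  cutRoot : ∀ {A} → IPos (cut A)                 -- the ∗ vertex
  cutL    : ∀ {A} → Pos A → IPos (cut A)
  cutR    : ∀ {A} → Pos (dual A) → IPos (cut A)

data Vtx : List Item → Set where
  at   : ∀ {x Γ} → IPos x → Vtx (x ∷ Γ)
  skip : ∀ {x Γ} → Vtx Γ → Vtx (x ∷ Γ)

data Node : Set where
  atomN : Node
  connN : Conn → Node
  cutN  : Node

nodeP : ∀ {A} → Pos A → Node
nodeP {pos _}     here = atomN
nodeP {neg _}     here = atomN
nodeP {bin c _ _} here = connN c
nodeP (left p)  = nodeP p
nodeP (right p) = nodeP p

nodeI : ∀ {x} → IPos x → Node
nodeI (frmP p) = nodeP p
nodeI cutRoot  = cutN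
nodeI (cutL p) = nodeP p
nodeI (cutR p) = nodeP p

nodeV : ∀ {Δ} → Vtx Δ → Node
nodeV (at p)   = nodeI p
nodeV (skip v) = nodeV v

IsLeaf : ∀ {Δ} → Vtx Δ → Set
IsLeaf v = nodeV v ≡ atomN

-- u ≼ v : u lies on the path from the root of its tree to v
-- (u is "below" v, or equal to v)
data _≼P_ : ∀ {A} → Pos A → Pos A → Set where
  here≼  : ∀ {A} {q : Pos A} → here ≼P q
  left≼  : ∀ {c A B} {p q : Pos A} → p ≼P q → left {c} {A} {B} p ≼P left q
  right≼ : ∀ {c A B} {p q : Pos B} → p ≼P q → right {c} {A} {B} p ≼P right q

data _≼I_ : ∀ {x} → IPos x → IPos x → Set where
  root≼ : ∀ {A} {q : IPos (cut A)} → cutRoot ≼I q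
  frm≼  : ∀ {A} {p q : Pos A} → p ≼P q → frmP p ≼I frmP q
  cutL≼ : ∀ {A} {p q : Pos A} → p ≼P q → cutL {A} p ≼I cutL q
  cutR≼ : ∀ {A} {p q : Pos (dual A)} → p ≼P q → cutR {A} p ≼I cutR q

data _≼V_ : ∀ {Δ} → Vtx Δ → Vtx Δ → Set where
  at≼   : ∀ {x Γ} {p q : IPos x} → p ≼I q → at {x} {Γ} p ≼V at q
  skip≼ : ∀ {x Γ} {u v : Vtx Γ} → u ≼V v → skip {x} u ≼V skip v

data Dir : Set where
  dl dr : Dir

data ChildP : Dir → ∀ {A} → Pos A → Pos A → Set where
  cl  : ∀ {c A B} → ChildP dl {bin c A B} here (left here)
  cr  : ∀ {c A B} → ChildP dr {bin c A B} here (right here)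
  inL : ∀ {d c A B} {p q : Pos A} → ChildP d p q → ChildP d (left {c} {A} {B} p) (left q)
  inR : ∀ {d c A B} {p q : Pos B} → ChildP d p q → ChildP d (right {c} {A} {B} p) (right q)

data ChildI : Dir → ∀ {x} → IPos x → IPos x → Set where
  frmC  : ∀ {d A} {p q : Pos A} → ChildP d p q → ChildI d (frmP p) (frmP q)
  cutCl : ∀ {A} → ChildI dl {cut A} cutRoot (cutL here)
  cutCr : ∀ {A} → ChildI dr {cut A} cutRoot (cutR here)
  cutLC : ∀ {d A} {p q : Pos A} → ChildP d p q → ChildI d (cutL {A} p) (cutL q)
  cutRC : ∀ {d A} {p q : Pos (dual A)} → ChildP d p q → ChildI d (cutR {A} p) (cutR q)

data ChildV : Dir → ∀ {Δ} → Vtx Δ → Vtx Δ → Set where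
  atC   : ∀ {d x Γ} {p q : IPos x} → ChildI d p q → ChildV d (at {x} {Γ} p) (at q)
  skipC : ∀ {d x Γ} {u v : Vtx Γ} → ChildV d u v → ChildV d (skip {x} u) (skip v)

-- Sequents are lists; the conclusion of every rule may
-- place the principal formula anywhere (Ins) and interleave the
-- contexts of the premises arbitrarily, the active formulas of the
-- premises being at their head.  This realises implicit exchange while
-- keeping track of formula occurrences.

data Ins (x : Item) : List Item → List Item → Set where
  ins-here  : ∀ {Γ} → Ins x Γ (x ∷ Γ)
  ins-there : ∀ {y Γ Δ} → Ins x Γ Δ → Ins x (y ∷ Γ) (y ∷ Δ)

-- context split of the &-rule:  Ω₁,Ω₂,Γ  into  Ω₁,Γ  and  Ω₂,Γ,
-- Ω₁, Ω₂ consisting of cut formulas only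
data Split3 : List Item → List Item → List Item → Set where
  []    : Split3 [] [] []
  onlyL : ∀ {x Γ₁ Γ₂ Γ} → IsCut x → Split3 Γ₁ Γ₂ Γ → Split3 (x ∷ Γ₁) Γ₂ (x ∷ Γ)
  onlyR : ∀ {x Γ₁ Γ₂ Γ} → IsCut x → Split3 Γ₁ Γ₂ Γ → Split3 Γ₁ (x ∷ Γ₂) (x ∷ Γ)
  both  : ∀ {x Γ₁ Γ₂ Γ} → Split3 Γ₁ Γ₂ Γ → Split3 (x ∷ Γ₁) (x ∷ Γ₂) (x ∷ Γ)

data Proof : List Item → Set where
  ax⁺  : ∀ n → Proof (frm (pos n) ∷ frm (neg n) ∷ [])
  ax⁻  : ∀ n → Proof (frm (neg n) ∷ frm (pos n) ∷ [])
  ⊗-r  : ∀ {A B Γ Γ₁ Γ₂ Δ} → Ins (frm (bin tens A B)) Γ Δ → Interleaving Γ₁ Γ₂ Γ →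
         Proof (frm A ∷ Γ₁) → Proof (frm B ∷ Γ₂) → Proof Δ
  ⅋-r  : ∀ {A B Γ Δ} → Ins (frm (bin parr A B)) Γ Δ →
         Proof (frm A ∷ frm B ∷ Γ) → Proof Δ
  &-r  : ∀ {A B Γ Γ₁ Γ₂ Δ} → Ins (frm (bin wth A B)) Γ Δ → Split3 Γ₁ Γ₂ Γ →
         Proof (frm A ∷ Γ₁) → Proof (frm B ∷ Γ₂) → Proof Δ
  ⊕₁-r : ∀ {A B Γ Δ} → Ins (frm (bin plus A B)) Γ Δ → Proof (frm A ∷ Γ) → Proof Δ
  ⊕₂-r : ∀ {A B Γ Δ} → Ins (frm (bin plus A B)) Γ Δ → Proof (frm B ∷ Γ) → Proof Δ
  cut-r : ∀ {A Γ Γ₁ Γ₂ Δ} → Ins (cut A) Γ Δ → Interleaving Γ₁ Γ₂ Γ →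
         Proof (frm A ∷ Γ₁) → Proof (frm (dual A) ∷ Γ₂) → Proof Δ

insV : ∀ {x Γ Δ} → Ins x Γ Δ → Vtx Γ → Vtx Δ
insV ins-here      v        = skip v
insV (ins-there o) (at p)   = at p
insV (ins-there o) (skip v) = skip (insV o v)

insP : ∀ {x Γ Δ} → Ins x Γ Δ → IPos x → Vtx Δ
insP ins-here      p = at p
insP (ins-there o) p = skip (insP o p)

ilL : ∀ {Γ₁ Γ₂ Γ} → Interleaving Γ₁ Γ₂ Γ → Vtx Γ₁ → Vtx Γ
ilL (consˡ s) (at p)   = at p
ilL (consˡ s) (skip v) = skip (ilL s v)
ilL (consʳ s) v        = skip (ilL s v)

ilR : ∀ {Γ₁ Γ₂ Γ} → Interleaving Γ₁ Γ₂ Γ → Vtx Γ₂ → Vtx Γ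
ilR (consʳ s) (at p)   = at p
ilR (consʳ s) (skip v) = skip (ilR s v)
ilR (consˡ s) v        = skip (ilR s v)

s3L : ∀ {Γ₁ Γ₂ Γ} → Split3 Γ₁ Γ₂ Γ → Vtx Γ₁ → Vtx Γ
s3L (onlyL _ s) (at p)   = at p
s3L (onlyL _ s) (skip v) = skip (s3L s v)
s3L (onlyR _ s) v        = skip (s3L s v)
s3L (both s)    (at p)   = at p
s3L (both s)    (skip v) = skip (s3L s v)

s3R : ∀ {Γ₁ Γ₂ Γ} → Split3 Γ₁ Γ₂ Γ → Vtx Γ₂ → Vtx Γ
s3R (onlyR _ s) (at p)   = at p
s3R (onlyR _ s) (skip v) = skip (s3R s v)
s3R (onlyL _ s) v        = skip (s3R s v)
s3R (both s)    (at p)   = at p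
s3R (both s)    (skip v) = skip (s3R s v)

hd : ∀ {x Γ Δ} → (IPos x → Vtx Δ) → (Vtx Γ → Vtx Δ) → Vtx (x ∷ Γ) → Vtx Δ
hd f g (at p)   = f p
hd f g (skip v) = g v

inLeft : ∀ {c A B} → IPos (frm A) → IPos (frm (bin c A B))
inLeft (frmP p) = frmP (left p)

inRight : ∀ {c A B} → IPos (frm B) → IPos (frm (bin c A B))
inRight (frmP p) = frmP (right p)

toCutL : ∀ {A} → IPos (frm A) → IPos (cut A)
toCutL (frmP p) = cutL p

toCutR : ∀ {A} → IPos (frm (dual A)) → IPos (cut A)
toCutR (frmP p) = cutR p

Link : List Item → Set
Link Δ = Vtx Δ × Vtx Δ

-- a linking: a (finite) set of links, given by a list
LinkSet : List Item → Set
LinkSet Δ = List (Link Δ)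

mapLink : ∀ {Δ Δ'} → (Vtx Δ → Vtx Δ') → Link Δ → Link Δ'
mapLink f (u , v) = f u , f v

-- &-resolutions: one branch above each &-rule is kept
Res : ∀ {Δ} → Proof Δ → Set
Res (ax⁺ n)          = ⊤
Res (ax⁻ n)          = ⊤
Res (⊗-r o s p q)    = Res p × Res q
Res (⅋-r o p)        = Res p
Res (&-r o s p q)    = Res p ⊎ Res q
Res (⊕₁-r o p)       = Res p
Res (⊕₂-r o p)       = Res p
Res (cut-r o s p q)  = Res p × Res q

links : ∀ {Δ} (Π : Proof Δ) → Res Π → LinkSet Δ
links (ax⁺ n) _ = (at (frmP here) , skip (at (frmP here))) ∷ []
links (ax⁻ n) _ = (at (frmP here) , skip (at (frmP here))) ∷ []
links (⊗-r o s p q) (r₁ , r₂) =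
  map (mapLink (hd (λ i → insP o (inLeft i))  (λ v → insV o (ilL s v)))) (links p r₁) ++
  map (mapLink (hd (λ i → insP o (inRight i)) (λ v → insV o (ilR s v)))) (links q r₂)
links (⅋-r o p) r =
  map (mapLink (hd (λ i → insP o (inLeft i)) (hd (λ i → insP o (inRight i)) (insV o)))) (links p r)
links (&-r o s p q) (inj₁ r) =
  map (mapLink (hd (λ i → insP o (inLeft i))  (λ v → insV o (s3L s v)))) (links p r)
links (&-r o s p q) (inj₂ r) =
  map (mapLink (hd (λ i → insP o (inRight i)) (λ v → insV o (s3R s v)))) (links q r)
links (⊕₁-r o p) r = map (mapLink (hd (λ i → insP o (inLeft i))  (insV o))) (links p r)
links (⊕₂-r o p) r = map (mapLink (hd (λ i → insP o (inRight i)) (insV o))) (links p r)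
links (cut-r o s p q) (r₁ , r₂) =
  map (mapLink (hd (λ i → insP o (toCutL i)) (λ v → insV o (ilL s v)))) (links p r₁) ++
  map (mapLink (hd (λ i → insP o (toCutR i)) (λ v → insV o (ilR s v)))) (links q r₂)

-- links are unordered pairs of leaves
LinkIn : ∀ {Δ} → Link Δ → LinkSet Δ → Set
LinkIn (u , v) λ′ = ((u , v) ∈ λ′) ⊎ ((v , u) ∈ λ′)

_≈L_ : ∀ {Δ} → LinkSet Δ → LinkSet Δ → Set
λ₁ ≈L λ₂ = ∀ a → (LinkIn a λ₁ → LinkIn a λ₂) × (LinkIn a λ₂ → LinkIn a λ₁)

Linkings : List Item → Set₁
Linkings Δ = LinkSet Δ → Set

θ : ∀ {Δ} → Proof Δ → Linkings Δ
θ Π λ′ = Σ (Res Π) (λ R → links Π R ≡ λ′)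

SameNet : ∀ {Δ} → Proof Δ → Proof Δ → Set
SameNet Π Π′ =
  (∀ R → Σ (Res Π′) (λ R′ → links Π R ≈L links Π′ R′)) ×
  (∀ R′ → Σ (Res Π) (λ R → links Π R ≈L links Π′ R′))

-- v is a vertex of Γ↾Λ : v is below a leaf occurring in a link of Λ
Kept : ∀ {Δ} → Linkings Δ → Vtx Δ → Set
Kept {Δ} Λ v = Σ (LinkSet Δ) λ λ′ → Λ λ′ × Σ (Vtx Δ) λ e → Σ (Vtx Δ) λ y →
                 LinkIn (e , y) λ′ × IsLeaf e × v ≼V e

Toggled : ∀ {Δ} → Linkings Δ → Vtx Δ → Set
Toggled {Δ} Λ w = nodeV w ≡ connN wth ×
  Σ (Vtx Δ) (λ l → ChildV dl w l × Kept Λ l) ×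
  Σ (Vtx Δ) (λ r → ChildV dr w r × Kept Λ r)

Pair : ∀ {Δ} → LinkSet Δ → LinkSet Δ → Linkings Δ
Pair λ₁ λ₂ μ = (μ ≡ λ₁) ⊎ (μ ≡ λ₂)

Depends : ∀ {Δ} → Linkings Δ → Link Δ → Vtx Δ → Set
Depends {Δ} Λ a w = Σ (LinkSet Δ) λ λ₁ → Σ (LinkSet Δ) λ λ₂ →
  Λ λ₁ × Λ λ₂ × LinkIn a λ₁ × ¬ LinkIn a λ₂ ×
  Toggled (Pair λ₁ λ₂) w × (∀ w′ → Toggled (Pair λ₁ λ₂) w′ → w′ ≡ w)

-- (directed presentation of the) edges of G(Λ):
-- tree edges of Γ↾Λ, link edges, jump edges (leaf of a link → & it depends on)
Edge : ∀ {Δ} → Linkings Δ → Vtx Δ → Vtx Δ → Set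
Edge {Δ} Λ u v =
  (Kept Λ u × Kept Λ v × (ChildV dl u v ⊎ ChildV dr u v)) ⊎
  (Σ (LinkSet Δ) λ λ′ → Λ λ′ × LinkIn (u , v) λ′) ⊎
  (Σ (Vtx Δ) λ y → Depends Λ (u , y) v)

Adj : ∀ {Δ} → Linkings Δ → Vtx Δ → Vtx Δ → Set
Adj Λ u v = Edge Λ u v ⊎ Edge Λ v u

Connected : ∀ {Δ} → Linkings Δ → Set
Connected Λ = ∀ u v → Kept Λ u → Kept Λ v → Star (Adj Λ) u v

CycleThrough : ∀ {Δ} → Linkings Δ → Vtx Δ → Set
CycleThrough {Δ} Λ v = Σ (Vtx Δ) λ x → Σ (List (Vtx Δ)) λ xs →
  2 ≤ length xs × Unique (x ∷ xs) × Linked (Adj Λ) (x ∷ xs ++ x ∷ []) × v ∈ (x ∷ xs)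

-- Separation.  The item occurrence A is given by its embedding r of
-- positions into the sequent.

Sep : ∀ {Δ} → Linkings Δ → (x : Item) → (IPos x → Vtx Δ) → Set
Sep Λ (frm (pos _))        r = ⊥
Sep Λ (frm (neg _))        r = ⊥
Sep Λ (frm (bin parr _ _)) r = ⊤
Sep Λ (frm (bin wth _ _))  r = ⊤
Sep Λ (frm (bin plus _ _)) r =
  (¬ Kept Λ (r (frmP (left here)))) ⊎ (¬ Kept Λ (r (frmP (right here))))
Sep Λ (frm (bin tens _ _)) r = ¬ CycleThrough Λ (r (frmP here))
Sep Λ (cut _)              r = ¬ CycleThrough Λ (r cutRoot)

Separates : ∀ {Δ x Γ} → Linkings Δ → Ins x Γ Δ → Set
Separates {x = x} Λ o = Sep Λ x (insP o)

-- Rule instances (a rule applied to the conclusion Δ: the principal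
-- occurrence and the distribution of the context among the premises)

data RuleInst (Δ : List Item) : Set where
  iAx⁺ : ℕ → RuleInst Δ
  iAx⁻ : ℕ → RuleInst Δ
  i⊗   : ∀ {A B Γ Γ₁ Γ₂} → Ins (frm (bin tens A B)) Γ Δ → Interleaving Γ₁ Γ₂ Γ → RuleInst Δ
  i⅋   : ∀ {A B Γ} → Ins (frm (bin parr A B)) Γ Δ → RuleInst Δ
  i&   : ∀ {A B Γ Γ₁ Γ₂} → Ins (frm (bin wth A B)) Γ Δ → Split3 Γ₁ Γ₂ Γ → RuleInst Δ
  i⊕₁  : ∀ {A B Γ} → Ins (frm (bin plus A B)) Γ Δ → RuleInst Δ
  i⊕₂  : ∀ {A B Γ} → Ins (frm (bin plus A B)) Γ Δ → RuleInst Δ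
  icut : ∀ {A Γ Γ₁ Γ₂} → Ins (cut A) Γ Δ → Interleaving Γ₁ Γ₂ Γ → RuleInst Δ

lastRule : ∀ {Δ} → Proof Δ → RuleInst Δ
lastRule (ax⁺ n)         = iAx⁺ n
lastRule (ax⁻ n)         = iAx⁻ n
lastRule (⊗-r o s p q)   = i⊗ o s
lastRule (⅋-r o p)       = i⅋ o
lastRule (&-r o s p q)   = i& o s
lastRule (⊕₁-r o p)      = i⊕₁ o
lastRule (⊕₂-r o p)      = i⊕₂ o
lastRule (cut-r o s p q) = icut o s

OccIn : List Item → Set
OccIn Δ = Σ Item λ x → Σ (List Item) λ Γ → Ins x Γ Δ

principal : ∀ {Δ} → RuleInst Δ → Maybe (OccIn Δ)
principal (iAx⁺ n)   = nothing
principal (iAx⁻ n)   = nothing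
principal (i⊗ o s)   = just (_ , _ , o)
principal (i⅋ o)     = just (_ , _ , o)
principal (i& o s)   = just (_ , _ , o)
principal (i⊕₁ o)    = just (_ , _ , o)
principal (i⊕₂ o)    = just (_ , _ , o)
principal (icut o s) = just (_ , _ , o)

Generates : ∀ {Δ x Γ} → RuleInst Δ → Ins x Γ Δ → Set
Generates σ o = principal σ ≡ just (_ , _ , o)

module Submission where

-- The connective α fixes the kind of rule, so only the distribution of
-- the context among the premises can differ:
--  * ⅋, ⊕: nothing to distribute.  ⊕₁ against ⊕₂ is impossible, since
--    every linking of a ⊕₁-proof reaches A₁ and none of a ⊕₂-proof does.
--  * &: a context item is in the left premise iff a left-branch linking
--    covers it, and left-branch linkings are recognisable in the net.
--  * ⊗, cut: link and jump edges of G(θ) stay on one side (premise) and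
--    tree edges stay in one item, so an item put on different sides by
--    the two rules could not be connected to the root of A.

open import Defs
open import Data.Bool using (Bool; true; false)
open import Data.Bool.Properties using (⇔→≡)
open import Data.Empty using (⊥; ⊥-elim)
open import Data.List using (List; []; _∷_; _++_; map)
open import Data.List.Membership.Propositional using (_∈_)
open import Data.List.Membership.Propositional.Properties using (∈-map⁺; ∈-map⁻; ∈-++⁺ˡ; ∈-++⁺ʳ; ∈-++⁻)
open import Data.List.Relation.Unary.Any using (here)
open import Data.List.Relation.Ternary.Interleaving using ([])
open import Data.List.Relation.Ternary.Interleaving.Propositional using (Interleaving; consˡ; consʳ)
open import Data.Product using (Σ; _×_; _,_; proj₁; proj₂)
open import Data.Sum using (_⊎_; inj₁; inj₂; [_,_]′; map₂)
open import Data.Unit using (tt)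
open import Function.Bundles using (mk⇔)
open import Relation.Nullary using (¬_)
open import Relation.Binary.PropositionalEquality using (_≡_; _≢_; refl; sym; trans; cong; subst; subst₂; cong₂)
open import Function.Base using (_∘_)
open import Relation.Binary.Construct.Closure.ReflexiveTransitive using (Star; fold)

rootI : (x : Item) → IPos x
rootI (frm A) = frmP here
rootI (cut A) = cutRoot

data Occ : List Item → Set where
  first : ∀ {x Γ} → Occ (x ∷ Γ)
  next  : ∀ {x Γ} → Occ Γ → Occ (x ∷ Γ)

itemOf : ∀ {Δ} → Occ Δ → Item
itemOf (first {x}) = x
itemOf (next j)    = itemOf j

rootV : ∀ {Δ} → Occ Δ → Vtx Δ
rootV (first {x}) = at (rootI x)
rootV (next j)    = skip (rootV j)

reflP : ∀ {A} (p : Pos A) → p ≼P p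
reflP here      = here≼
reflP (left p)  = left≼ (reflP p)
reflP (right p) = right≼ (reflP p)

reflI : ∀ {x} (p : IPos x) → p ≼I p
reflI (frmP p) = frm≼ (reflP p)
reflI cutRoot  = root≼
reflI (cutL p) = cutL≼ (reflP p)
reflI (cutR p) = cutR≼ (reflP p)

reflV : ∀ {Δ} (v : Vtx Δ) → v ≼V v
reflV (at p)   = at≼ (reflI p)
reflV (skip v) = skip≼ (reflV v)

transP : ∀ {A} {p q r : Pos A} → p ≼P q → q ≼P r → p ≼P r
transP here≼      _          = here≼
transP (left≼ a)  (left≼ b)  = left≼ (transP a b)
transP (right≼ a) (right≼ b) = right≼ (transP a b)

transI : ∀ {x} {p q r : IPos x} → p ≼I q → q ≼I r → p ≼I r
transI root≼     _         = root≼
transI (frm≼ a)  (frm≼ b)  = frm≼ (transP a b)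
transI (cutL≼ a) (cutL≼ b) = cutL≼ (transP a b)
transI (cutR≼ a) (cutR≼ b) = cutR≼ (transP a b)

transV : ∀ {Δ} {p q r : Vtx Δ} → p ≼V q → q ≼V r → p ≼V r
transV (at≼ a)   (at≼ b)   = at≼ (transI a b)
transV (skip≼ a) (skip≼ b) = skip≼ (transV a b)

rootLe : ∀ x (q : IPos x) → rootI x ≼I q
rootLe (frm A) (frmP q) = frm≼ here≼
rootLe (cut A) q        = root≼

-- Every rule embeds the vertices
-- of its premises into its conclusion by such maps, and everything the
-- graph G(Λ) is built from (leaves, Kept, Toggled) is transported along
-- them.

record TreeMap {Δ Δ′} (F : Vtx Δ → Vtx Δ′) : Set where
  field
    node-pres  : ∀ v → nodeV (F v) ≡ nodeV v
    child-pres : ∀ {d u v} → ChildV d u v → ChildV d (F u) (F v)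
    ≼-pres     : ∀ {u v} → u ≼V v → F u ≼V F v
open TreeMap public

record TreeMapI {x Δ} (F : IPos x → Vtx Δ) : Set where
  field
    nodeI-pres  : ∀ v → nodeV (F v) ≡ nodeI v
    childI-pres : ∀ {d u v} → ChildI d u v → ChildV d (F u) (F v)
    ≼I-pres     : ∀ {u v} → u ≼I v → F u ≼V F v
open TreeMapI public

record TreeMapII {x y} (F : IPos x → IPos y) : Set where
  field
    nodeII-pres  : ∀ v → nodeI (F v) ≡ nodeI v
    childII-pres : ∀ {d u v} → ChildI d u v → ChildI d (F u) (F v)
    ≼II-pres     : ∀ {u v} → u ≼I v → F u ≼I F v
open TreeMapII public

idTM : ∀ {Δ} → TreeMap {Δ} (λ v → v)
idTM = record { node-pres = λ _ → refl ; child-pres = λ c → c ; ≼-pres = λ l → l }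

emptyTM : ∀ {Δ} {F : Vtx [] → Vtx Δ} → TreeMap F
emptyTM = record { node-pres = λ () ; child-pres = λ () ; ≼-pres = λ () }

skipTM : ∀ {x Δ Δ′} {F : Vtx Δ → Vtx Δ′} → TreeMap F → TreeMap (λ v → skip {x} (F v))
skipTM t = record
  { node-pres = node-pres t ; child-pres = λ c → skipC (child-pres t c) ; ≼-pres = λ l → skip≼ (≼-pres t l) }

consTM : ∀ {x Δ Δ′} {F : Vtx Δ → Vtx Δ′} {G : Vtx (x ∷ Δ) → Vtx (x ∷ Δ′)} →
  (∀ p → G (at p) ≡ at p) → (∀ v → G (skip v) ≡ skip (F v)) → TreeMap F → TreeMap G
consTM {F = F} {G} eat eskip t = record { node-pres = nd ; child-pres = ch ; ≼-pres = le }
  where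
  nd : ∀ v → nodeV (G v) ≡ nodeV v
  nd (at p)   rewrite eat p   = refl
  nd (skip v) rewrite eskip v = node-pres t v
  ch : ∀ {d u v} → ChildV d u v → ChildV d (G u) (G v)
  ch (atC {p = p} {q} c)   rewrite eat p | eat q     = atC c
  ch (skipC {u = u} {v} c) rewrite eskip u | eskip v = skipC (child-pres t c)
  le : ∀ {u v} → u ≼V v → G u ≼V G v
  le (at≼ {p = p} {q} l)   rewrite eat p | eat q     = at≼ l
  le (skip≼ {u = u} {v} l) rewrite eskip u | eskip v = skip≼ (≼-pres t l)

compI : ∀ {x y Δ} {F : IPos y → Vtx Δ} {H : IPos x → IPos y} → TreeMapI F → TreeMapII H → TreeMapI (λ i → F (H i))
compI f h = record
  { nodeI-pres = λ v → trans (nodeI-pres f _) (nodeII-pres h v)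
  ; childI-pres = λ c → childI-pres f (childII-pres h c)
  ; ≼I-pres = λ l → ≼I-pres f (≼II-pres h l) }

compV : ∀ {Δ₁ Δ₂ Δ₃} {F : Vtx Δ₂ → Vtx Δ₃} {H : Vtx Δ₁ → Vtx Δ₂} → TreeMap F → TreeMap H → TreeMap (λ v → F (H v))
compV f h = record
  { node-pres = λ v → trans (node-pres f _) (node-pres h v)
  ; child-pres = λ c → child-pres f (child-pres h c)
  ; ≼-pres = λ l → ≼-pres f (≼-pres h l) }

hdTM : ∀ {x Γ Δ} {f : IPos x → Vtx Δ} {g : Vtx Γ → Vtx Δ} → TreeMapI f → TreeMap g → TreeMap (hd f g)
hdTM {f = f} {g} tf tg = record { node-pres = nd ; child-pres = ch ; ≼-pres = le }
  where
  nd : ∀ v → nodeV (hd f g v) ≡ nodeV v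
  nd (at p)   = nodeI-pres tf p
  nd (skip v) = node-pres tg v
  ch : ∀ {d u v} → ChildV d u v → ChildV d (hd f g u) (hd f g v)
  ch (atC c)   = childI-pres tf c
  ch (skipC c) = child-pres tg c
  le : ∀ {u v} → u ≼V v → hd f g u ≼V hd f g v
  le (at≼ l)   = ≼I-pres tf l
  le (skip≼ l) = ≼-pres tg l

insPTM : ∀ {x Γ Δ} (o : Ins x Γ Δ) → TreeMapI (insP o)
insPTM ins-here      = record { nodeI-pres = λ _ → refl ; childI-pres = atC ; ≼I-pres = at≼ }
insPTM (ins-there o) = record
  { nodeI-pres = nodeI-pres (insPTM o)
  ; childI-pres = λ c → skipC (childI-pres (insPTM o) c)
  ; ≼I-pres = λ l → skip≼ (≼I-pres (insPTM o) l) }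

insVTM : ∀ {x Γ Δ} (o : Ins x Γ Δ) → TreeMap (insV o)
insVTM ins-here      = skipTM idTM
insVTM (ins-there o) = consTM (λ _ → refl) (λ _ → refl) (insVTM o)

ilLTM : ∀ {Γ₁ Γ₂ Γ} (s : Interleaving Γ₁ Γ₂ Γ) → TreeMap (ilL s)
ilLTM []        = emptyTM
ilLTM (consˡ s) = consTM (λ _ → refl) (λ _ → refl) (ilLTM s)
ilLTM (consʳ s) = skipTM (ilLTM s)

ilRTM : ∀ {Γ₁ Γ₂ Γ} (s : Interleaving Γ₁ Γ₂ Γ) → TreeMap (ilR s)
ilRTM []        = emptyTM
ilRTM (consʳ s) = consTM (λ _ → refl) (λ _ → refl) (ilRTM s)
ilRTM (consˡ s) = skipTM (ilRTM s)

s3LTM : ∀ {Γ₁ Γ₂ Γ} (s : Split3 Γ₁ Γ₂ Γ) → TreeMap (s3L s)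
s3LTM []          = emptyTM
s3LTM (onlyL _ s) = consTM (λ _ → refl) (λ _ → refl) (s3LTM s)
s3LTM (both s)    = consTM (λ _ → refl) (λ _ → refl) (s3LTM s)
s3LTM (onlyR _ s) = skipTM (s3LTM s)

s3RTM : ∀ {Γ₁ Γ₂ Γ} (s : Split3 Γ₁ Γ₂ Γ) → TreeMap (s3R s)
s3RTM []          = emptyTM
s3RTM (onlyR _ s) = consTM (λ _ → refl) (λ _ → refl) (s3RTM s)
s3RTM (both s)    = consTM (λ _ → refl) (λ _ → refl) (s3RTM s)
s3RTM (onlyL _ s) = skipTM (s3RTM s)

inLeftTM : ∀ {c A B} → TreeMapII (inLeft {c} {A} {B})
inLeftTM = record
  { nodeII-pres  = λ { (frmP p) → refl }
  ; childII-pres = λ { (frmC c) → frmC (inL c) }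
  ; ≼II-pres     = λ { (frm≼ l) → frm≼ (left≼ l) } }

inRightTM : ∀ {c A B} → TreeMapII (inRight {c} {A} {B})
inRightTM = record
  { nodeII-pres  = λ { (frmP p) → refl }
  ; childII-pres = λ { (frmC c) → frmC (inR c) }
  ; ≼II-pres     = λ { (frm≼ l) → frm≼ (right≼ l) } }

toCutLTM : ∀ {A} → TreeMapII (toCutL {A})
toCutLTM = record
  { nodeII-pres  = λ { (frmP p) → refl }
  ; childII-pres = λ { (frmC c) → cutLC c }
  ; ≼II-pres     = λ { (frm≼ l) → cutL≼ l } }

toCutRTM : ∀ {A} → TreeMapII (toCutR {A})
toCutRTM = record
  { nodeII-pres  = λ { (frmP p) → refl }
  ; childII-pres = λ { (frmC c) → cutRC c }
  ; ≼II-pres     = λ { (frm≼ l) → cutR≼ l } }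

-- This is exactly how 'links'
-- transports the links of a premise (⅋ has two active formulas).

prem : ∀ {x Γ Δ Γ′ A} → Ins x Γ Δ → (IPos (frm A) → IPos x) → (Vtx Γ′ → Vtx Γ) → Vtx (frm A ∷ Γ′) → Vtx Δ
prem o h k = hd (λ i → insP o (h i)) (λ v → insV o (k v))

premTM : ∀ {x Γ Δ Γ′ A} (o : Ins x Γ Δ) {h : IPos (frm A) → IPos x} {k : Vtx Γ′ → Vtx Γ} →
  TreeMapII h → TreeMap k → TreeMap (prem o h k)
premTM o th tk = hdTM (compI (insPTM o) th) (compV (insVTM o) tk)

parPrem : ∀ {A B Γ Δ} → Ins (frm (bin parr A B)) Γ Δ → Vtx (frm A ∷ frm B ∷ Γ) → Vtx Δ
parPrem o = hd (λ i → insP o (inLeft i)) (hd (λ i → insP o (inRight i)) (insV o))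

parTM : ∀ {A B Γ Δ} (o : Ins (frm (bin parr A B)) Γ Δ) → TreeMap (parPrem o)
parTM o = hdTM (compI (insPTM o) inLeftTM) (hdTM (compI (insPTM o) inRightTM) (insVTM o))

LinkInMap : ∀ {Δ Δ′} (F : Vtx Δ → Vtx Δ′) {L u v} → LinkIn (u , v) L → LinkIn (F u , F v) (map (mapLink F) L)
LinkInMap F (inj₁ m) = inj₁ (∈-map⁺ (mapLink F) m)
LinkInMap F (inj₂ m) = inj₂ (∈-map⁺ (mapLink F) m)

LinkInMap⁻ : ∀ {Δ Δ′} (F : Vtx Δ → Vtx Δ′) (L : LinkSet Δ) {u v} → LinkIn (u , v) (map (mapLink F) L) →
  Σ (Vtx Δ) λ c → Σ (Vtx Δ) λ d → LinkIn (c , d) L × u ≡ F c × v ≡ F d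
LinkInMap⁻ F L (inj₁ m) with ∈-map⁻ (mapLink F) m
... | (c , d) , m′ , refl = c , d , inj₁ m′ , refl , refl
LinkInMap⁻ F L (inj₂ m) with ∈-map⁻ (mapLink F) m
... | (c , d) , m′ , refl = d , c , inj₂ m′ , refl , refl

LinkIn++⁻ : ∀ {Δ} (X : LinkSet Δ) {Y a} → LinkIn a (X ++ Y) → LinkIn a X ⊎ LinkIn a Y
LinkIn++⁻ X (inj₁ m) = Data.Sum.map inj₁ inj₁ (∈-++⁻ X m)
LinkIn++⁻ X (inj₂ m) = Data.Sum.map inj₂ inj₂ (∈-++⁻ X m)

_⊑_ : ∀ {Δ} → LinkSet Δ → LinkSet Δ → Set
L ⊑ M = ∀ {a} → LinkIn a L → LinkIn a M

⊑-++ˡ : ∀ {Δ} {X Y : LinkSet Δ} → X ⊑ (X ++ Y)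
⊑-++ˡ (inj₁ m) = inj₁ (∈-++⁺ˡ m)
⊑-++ˡ (inj₂ m) = inj₂ (∈-++⁺ˡ m)

⊑-++ʳ : ∀ {Δ} (X : LinkSet Δ) {Y} → Y ⊑ (X ++ Y)
⊑-++ʳ X (inj₁ m) = inj₁ (∈-++⁺ʳ X m)
⊑-++ʳ X (inj₂ m) = inj₂ (∈-++⁺ʳ X m)

-- Links connect leaves: the axiom links are transported along tree maps,
-- which preserve leaves.

LeafLinks : ∀ {Δ} → LinkSet Δ → Set
LeafLinks L = ∀ {u v} → (u , v) ∈ L → IsLeaf u × IsLeaf v

leafMap : ∀ {Δ Δ′} {F : Vtx Δ → Vtx Δ′} {L} → TreeMap F → LeafLinks L → LeafLinks (map (mapLink F) L)
leafMap {F = F} tF h m with ∈-map⁻ (mapLink F) m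
... | (c , d) , m′ , refl = trans (node-pres tF c) (proj₁ (h m′)) , trans (node-pres tF d) (proj₂ (h m′))

leaf++ : ∀ {Δ} {X Y : LinkSet Δ} → LeafLinks X → LeafLinks Y → LeafLinks (X ++ Y)
leaf++ {X = X} hx hy m with ∈-++⁻ X m
... | inj₁ m′ = hx m′
... | inj₂ m′ = hy m′

leaves : ∀ {Δ} (Π : Proof Δ) R → LeafLinks (links Π R)
leaves (ax⁺ n) _ (here refl) = refl , refl
leaves (ax⁻ n) _ (here refl) = refl , refl
leaves (⊗-r o s p q) (r₁ , r₂) =
  leaf++ (leafMap (premTM o inLeftTM (ilLTM s)) (leaves p r₁)) (leafMap (premTM o inRightTM (ilRTM s)) (leaves q r₂))
leaves (⅋-r o p) r              = leafMap (parTM o) (leaves p r)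
leaves (&-r o s p q) (inj₁ r)   = leafMap (premTM o inLeftTM (s3LTM s)) (leaves p r)
leaves (&-r o s p q) (inj₂ r)   = leafMap (premTM o inRightTM (s3RTM s)) (leaves q r)
leaves (⊕₁-r o p) r             = leafMap (premTM o inLeftTM idTM) (leaves p r)
leaves (⊕₂-r o p) r             = leafMap (premTM o inRightTM idTM) (leaves p r)
leaves (cut-r o s p q) (r₁ , r₂) =
  leaf++ (leafMap (premTM o toCutLTM (ilLTM s)) (leaves p r₁)) (leafMap (premTM o toCutRTM (ilRTM s)) (leaves q r₂))

leafLinkIn : ∀ {Δ} {L : LinkSet Δ} {e y} → LeafLinks L → LinkIn (e , y) L → IsLeaf e
leafLinkIn h (inj₁ m) = proj₁ (h m)
leafLinkIn h (inj₂ m) = proj₂ (h m)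

someRes : ∀ {Δ} (Π : Proof Δ) → Res Π
someRes (ax⁺ n)         = tt
someRes (ax⁻ n)         = tt
someRes (⊗-r o s p q)   = someRes p , someRes q
someRes (⅋-r o p)       = someRes p
someRes (&-r o s p q)   = inj₁ (someRes p)
someRes (⊕₁-r o p)      = someRes p
someRes (⊕₂-r o p)      = someRes p
someRes (cut-r o s p q) = someRes p , someRes q

-- We show
-- that the root of every item of the conclusion is covered: by every
-- linking of θ_Π if the item is not a cut, by some linking otherwise.

CovBy : ∀ {Δ} → LinkSet Δ → Vtx Δ → Set
CovBy {Δ} L v = Σ (Vtx Δ) λ e → Σ (Vtx Δ) λ y → LinkIn (e , y) L × v ≼V e

covMap : ∀ {Δ Δ′} {F : Vtx Δ → Vtx Δ′} {L : LinkSet Δ} {w v} → TreeMap F → v ≼V F w → CovBy L w →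
  CovBy (map (mapLink F) L) v
covMap {F = F} tF h (e , y , li , le) = F e , F y , LinkInMap F li , transV h (≼-pres tF le)

covSub : ∀ {Δ} {L M : LinkSet Δ} {v} → L ⊑ M → CovBy L v → CovBy M v
covSub f (e , y , li , le) = e , y , f li , le

record Corr {Γ Δ} (F : Vtx Γ → Vtx Δ) (j : Occ Δ) (j′ : Occ Γ) : Set where
  constructor corr
  field
    sameItem : itemOf j ≡ itemOf j′
    sameRoot : rootV j ≡ F (rootV j′)

corr∘ : ∀ {Γ₁ Γ Δ} {F : Vtx Γ → Vtx Δ} {G : Vtx Γ₁ → Vtx Γ} {j j′ j″} →
  Corr F j j′ → Corr G j′ j″ → Corr (λ v → F (G v)) j j″
corr∘ {F = F} (corr ei ev) (corr ei′ ev′) = corr (trans ei ei′) (trans ev (cong F ev′))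

record Above {Γ Δ} (F : Vtx Γ → Vtx Δ) (j : Occ Δ) (j′ : Occ Γ) : Set where
  constructor above
  field
    below  : rootV j ≼V F (rootV j′)
    nonCut : ¬ IsCut (itemOf j) → ¬ IsCut (itemOf j′)

≡⇒≼ : ∀ {Δ} {u v : Vtx Δ} → u ≡ v → u ≼V v
≡⇒≼ refl = reflV _

corrAbove : ∀ {Γ Δ} {F : Vtx Γ → Vtx Δ} {j j′} → Corr F j j′ → Above F j j′
corrAbove (corr ei ev) = above (≡⇒≼ ev) (subst (λ y → ¬ IsCut y) ei)

premCorr : ∀ {x Γ Δ Γ′ A} {o : Ins x Γ Δ} {h : IPos (frm A) → IPos x} {k : Vtx Γ′ → Vtx Γ} {j j′} →
  Corr (λ v → insV o (k v)) j j′ → Above (prem o h k) j (next j′)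
premCorr (corr ei ev) = corrAbove (corr ei ev)

activeAbove : ∀ {x Γ Δ Γ′ A} (o : Ins x Γ Δ) (h : IPos (frm A) → IPos x) {F : Vtx (frm A ∷ Γ′) → Vtx Δ} →
  F (at (frmP here)) ≡ insP o (h (frmP here)) → ∀ {j} → rootV j ≡ insP o (rootI x) → Above F j first
activeAbove {x} o h eF ev =
  above (subst₂ _≼V_ (sym ev) (sym eF) (≼I-pres (insPTM o) (rootLe x (h (frmP here))))) λ _ ()

locateIns : ∀ {x Γ Δ} (o : Ins x Γ Δ) (j : Occ Δ) → rootV j ≡ insP o (rootI x) ⊎ Σ (Occ Γ) (Corr (insV o) j)
locateIns ins-here      first    = inj₁ refl
locateIns ins-here      (next j) = inj₂ (j , corr refl refl)
locateIns (ins-there o) first    = inj₂ (first , corr refl refl)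
locateIns (ins-there o) (next j) =
  Data.Sum.map (cong skip) (λ { (j′ , corr ei ev) → next j′ , corr ei (cong skip ev) }) (locateIns o j)

locateIl : ∀ {Γ₁ Γ₂ Γ} (s : Interleaving Γ₁ Γ₂ Γ) (j : Occ Γ) →
  Σ (Occ Γ₁) (Corr (ilL s) j) ⊎ Σ (Occ Γ₂) (Corr (ilR s) j)
locateIl (consˡ s) first    = inj₁ (first , corr refl refl)
locateIl (consʳ s) first    = inj₂ (first , corr refl refl)
locateIl (consˡ s) (next j) =
  Data.Sum.map (λ { (j₁ , corr ei ev) → next j₁ , corr ei (cong skip ev) })
               (λ { (j₂ , corr ei ev) → j₂ , corr ei (cong skip ev) }) (locateIl s j)
locateIl (consʳ s) (next j) =
  Data.Sum.map (λ { (j₁ , corr ei ev) → j₁ , corr ei (cong skip ev) })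
               (λ { (j₂ , corr ei ev) → next j₂ , corr ei (cong skip ev) }) (locateIl s j)

-- (goes to the left premise?, goes to the right premise?)
destination : ∀ {Γ₁ Γ₂ Γ} → Split3 Γ₁ Γ₂ Γ → Vtx Γ → Bool × Bool
destination (onlyL _ s) (at _)   = true , false
destination (onlyR _ s) (at _)   = false , true
destination (both s)    (at _)   = true , true
destination (onlyL _ s) (skip v) = destination s v
destination (onlyR _ s) (skip v) = destination s v
destination (both s)    (skip v) = destination s v

goesLeft goesRight : ∀ {Γ₁ Γ₂ Γ} → Split3 Γ₁ Γ₂ Γ → Vtx Γ → Bool
goesLeft  s v = proj₁ (destination s v)
goesRight s v = proj₂ (destination s v)

s3InvL : ∀ {Γ₁ Γ₂ Γ} (s : Split3 Γ₁ Γ₂ Γ) (j : Occ Γ) → goesLeft s (rootV j) ≡ true → Σ (Occ Γ₁) (Corr (s3L s) j)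
s3InvL (onlyL _ s) first    _ = first , corr refl refl
s3InvL (both s)    first    _ = first , corr refl refl
s3InvL (onlyL _ s) (next j) e = let (j₁ , corr ei ev) = s3InvL s j e in next j₁ , corr ei (cong skip ev)
s3InvL (both s)    (next j) e = let (j₁ , corr ei ev) = s3InvL s j e in next j₁ , corr ei (cong skip ev)
s3InvL (onlyR _ s) (next j) e = let (j₁ , corr ei ev) = s3InvL s j e in j₁ , corr ei (cong skip ev)

s3InvR : ∀ {Γ₁ Γ₂ Γ} (s : Split3 Γ₁ Γ₂ Γ) (j : Occ Γ) → goesRight s (rootV j) ≡ true → Σ (Occ Γ₂) (Corr (s3R s) j)
s3InvR (onlyR _ s) first    _ = first , corr refl refl
s3InvR (both s)    first    _ = first , corr refl refl
s3InvR (onlyR _ s) (next j) e = let (j₂ , corr ei ev) = s3InvR s j e in next j₂ , corr ei (cong skip ev)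
s3InvR (both s)    (next j) e = let (j₂ , corr ei ev) = s3InvR s j e in next j₂ , corr ei (cong skip ev)
s3InvR (onlyL _ s) (next j) e = let (j₂ , corr ei ev) = s3InvR s j e in j₂ , corr ei (cong skip ev)

nonCutBoth : ∀ {Γ₁ Γ₂ Γ} (s : Split3 Γ₁ Γ₂ Γ) (j : Occ Γ) → ¬ IsCut (itemOf j) →
  goesLeft s (rootV j) ≡ true × goesRight s (rootV j) ≡ true
nonCutBoth (onlyL i s) first    nc = ⊥-elim (nc i)
nonCutBoth (onlyR i s) first    nc = ⊥-elim (nc i)
nonCutBoth (both s)    first    nc = refl , refl
nonCutBoth (onlyL _ s) (next j) nc = nonCutBoth s j nc
nonCutBoth (onlyR _ s) (next j) nc = nonCutBoth s j nc
nonCutBoth (both s)    (next j) nc = nonCutBoth s j nc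

goesSomewhere : ∀ {Γ₁ Γ₂ Γ} (s : Split3 Γ₁ Γ₂ Γ) v → goesLeft s v ≡ false → goesRight s v ≡ true
goesSomewhere (onlyR _ s) (at _)   e = refl
goesSomewhere (onlyL _ s) (skip v) e = goesSomewhere s v e
goesSomewhere (onlyR _ s) (skip v) e = goesSomewhere s v e
goesSomewhere (both s)    (skip v) e = goesSomewhere s v e

Located : ∀ {Γ Δ} → (Vtx Γ → Vtx Δ) → Occ Δ → Set
Located {Γ} F j = Σ (Occ Γ) (Above F j)

located₂ : ∀ {x A B Γ Δ Γ₁ Γ₂} (o : Ins x Γ Δ) (s : Interleaving Γ₁ Γ₂ Γ)
  (hL : IPos (frm A) → IPos x) (hR : IPos (frm B) → IPos x) (j : Occ Δ) →
  Located (prem o hL (ilL s)) j ⊎ Located (prem o hR (ilR s)) j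
located₂ o s hL hR j with locateIns o j
... | inj₁ ev = inj₁ (first , activeAbove o hL refl ev)
... | inj₂ (j′ , c) with locateIl s j′
...   | inj₁ (j₁ , c₁) = inj₁ (next j₁ , premCorr (corr∘ c c₁))
...   | inj₂ (j₂ , c₂) = inj₂ (next j₂ , premCorr (corr∘ c c₂))

located₁ : ∀ {x A Γ Δ} (o : Ins x Γ Δ) (h : IPos (frm A) → IPos x) (j : Occ Δ) → Located (prem o h (λ v → v)) j
located₁ o h j with locateIns o j
... | inj₁ ev       = first , activeAbove o h refl ev
... | inj₂ (j′ , c) = next j′ , premCorr c

located⅋ : ∀ {A B Γ Δ} (o : Ins (frm (bin parr A B)) Γ Δ) (j : Occ Δ) → Located (parPrem o) j
located⅋ o j with locateIns o j
... | inj₁ ev       = first , activeAbove o inLeft refl ev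
... | inj₂ (j′ , corr ei ev) = next (next j′) , corrAbove (corr ei ev)

located&L : ∀ {A B Γ Δ Γ₁ Γ₂} (o : Ins (frm (bin wth A B)) Γ Δ) (s : Split3 Γ₁ Γ₂ Γ) (j : Occ Δ) →
  ¬ IsCut (itemOf j) → Located (prem o inLeft (s3L s)) j
located&L o s j nc with locateIns o j
... | inj₁ ev            = first , activeAbove o inLeft refl ev
... | inj₂ (j′ , c) =
  let (j₁ , c₁) = s3InvL s j′ (proj₁ (nonCutBoth s j′ (subst (λ y → ¬ IsCut y) (Corr.sameItem c) nc)))
  in next j₁ , premCorr (corr∘ c c₁)

located&R : ∀ {A B Γ Δ Γ₁ Γ₂} (o : Ins (frm (bin wth A B)) Γ Δ) (s : Split3 Γ₁ Γ₂ Γ) (j : Occ Δ) →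
  ¬ IsCut (itemOf j) → Located (prem o inRight (s3R s)) j
located&R o s j nc with locateIns o j
... | inj₁ ev            = first , activeAbove o inRight refl ev
... | inj₂ (j′ , c) =
  let (j₂ , c₂) = s3InvR s j′ (proj₂ (nonCutBoth s j′ (subst (λ y → ¬ IsCut y) (Corr.sameItem c) nc)))
  in next j₂ , premCorr (corr∘ c c₂)

located& : ∀ {A B Γ Δ Γ₁ Γ₂} (o : Ins (frm (bin wth A B)) Γ Δ) (s : Split3 Γ₁ Γ₂ Γ) (j : Occ Δ) →
  Located (prem o inLeft (s3L s)) j ⊎ Located (prem o inRight (s3R s)) j
located& o s j with locateIns o j
... | inj₁ ev       = inj₁ (first , activeAbove o inLeft refl ev)
... | inj₂ (j′ , c) with goesLeft s (rootV j′) in e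
...   | true  = let (j₁ , c₁) = s3InvL s j′ e in inj₁ (next j₁ , premCorr (corr∘ c c₁))
...   | false = let (j₂ , c₂) = s3InvR s j′ (goesSomewhere s _ e) in inj₂ (next j₂ , premCorr (corr∘ c c₂))

coverVia : ∀ {Γ Δ} {F : Vtx Γ → Vtx Δ} {L : LinkSet Γ} → TreeMap F →
  (∀ j′ → ¬ IsCut (itemOf j′) → CovBy L (rootV j′)) →
  ∀ {j} → Located F j → ¬ IsCut (itemOf j) → CovBy (map (mapLink F) L) (rootV j)
coverVia tF cov (j′ , above le nc⇒) nc = covMap tF le (cov j′ (nc⇒ nc))

coverViaE : ∀ {Γ Δ} {R : Set} {lk : R → LinkSet Γ} {F : Vtx Γ → Vtx Δ} → TreeMap F →
  (∀ j′ → Σ R λ r → CovBy (lk r) (rootV j′)) →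
  ∀ {j} → Located F j → Σ R λ r → CovBy (map (mapLink F) (lk r)) (rootV j)
coverViaE tF cov (j′ , above le _) = let (r , c) = cov j′ in r , covMap tF le c

coverAx : ∀ {a b} (j : Occ (frm a ∷ frm b ∷ [])) →
  CovBy ((at (frmP here) , skip (at (frmP here))) ∷ []) (rootV j)
coverAx first        = at (frmP here) , skip (at (frmP here)) , inj₁ (here refl) , reflV _
coverAx (next first) = skip (at (frmP here)) , at (frmP here) , inj₂ (here refl) , reflV _

cover : ∀ {Δ} (Π : Proof Δ) R (j : Occ Δ) → ¬ IsCut (itemOf j) → CovBy (links Π R) (rootV j)
cover (ax⁺ n) _ j _ = coverAx j
cover (ax⁻ n) _ j _ = coverAx j
cover (⊗-r o s p q) (r₁ , r₂) j = [ (λ l → covSub ⊑-++ˡ      ∘ coverVia (premTM o inLeftTM (ilLTM s)) (cover p r₁) l)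
                                  , (λ l → covSub (⊑-++ʳ _)  ∘ coverVia (premTM o inRightTM (ilRTM s)) (cover q r₂) l) ]′
                                  (located₂ o s inLeft inRight j)
cover (⅋-r o p) r j              = coverVia (parTM o) (cover p r) (located⅋ o j)
cover (&-r o s p q) (inj₁ r) j nc = coverVia (premTM o inLeftTM (s3LTM s)) (cover p r) (located&L o s j nc) nc
cover (&-r o s p q) (inj₂ r) j nc = coverVia (premTM o inRightTM (s3RTM s)) (cover q r) (located&R o s j nc) nc
cover (⊕₁-r o p) r j             = coverVia (premTM o inLeftTM idTM) (cover p r) (located₁ o inLeft j)
cover (⊕₂-r o p) r j             = coverVia (premTM o inRightTM idTM) (cover p r) (located₁ o inRight j)
cover (cut-r o s p q) (r₁ , r₂) j = [ (λ l → covSub ⊑-++ˡ     ∘ coverVia (premTM o toCutLTM (ilLTM s)) (cover p r₁) l)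
                                    , (λ l → covSub (⊑-++ʳ _) ∘ coverVia (premTM o toCutRTM (ilRTM s)) (cover q r₂) l) ]′
                                    (located₂ o s toCutL toCutR j)

coverSome : ∀ {Δ} (Π : Proof Δ) (j : Occ Δ) → Σ (Res Π) λ R → CovBy (links Π R) (rootV j)
coverSome (ax⁺ n) j = tt , coverAx j
coverSome (ax⁻ n) j = tt , coverAx j
coverSome (⊗-r o s p q) j with located₂ o s inLeft inRight j
... | inj₁ l = let (r₁ , c) = coverViaE (premTM o inLeftTM (ilLTM s)) (coverSome p) l in (r₁ , someRes q) , covSub ⊑-++ˡ c
... | inj₂ l = let (r₂ , c) = coverViaE (premTM o inRightTM (ilRTM s)) (coverSome q) l in (someRes p , r₂) , covSub (⊑-++ʳ _) c
coverSome (⅋-r o p) j = coverViaE (parTM o) (coverSome p) (located⅋ o j)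
coverSome (&-r o s p q) j with located& o s j
... | inj₁ l = let (r , c) = coverViaE (premTM o inLeftTM (s3LTM s)) (coverSome p) l in inj₁ r , c
... | inj₂ l = let (r , c) = coverViaE (premTM o inRightTM (s3RTM s)) (coverSome q) l in inj₂ r , c
coverSome (⊕₁-r o p) j = coverViaE (premTM o inLeftTM idTM) (coverSome p) (located₁ o inLeft j)
coverSome (⊕₂-r o p) j = coverViaE (premTM o inRightTM idTM) (coverSome p) (located₁ o inRight j)
coverSome (cut-r o s p q) j with located₂ o s toCutL toCutR j
... | inj₁ l = let (r₁ , c) = coverViaE (premTM o toCutLTM (ilLTM s)) (coverSome p) l in (r₁ , someRes q) , covSub ⊑-++ˡ c
... | inj₂ l = let (r₂ , c) = coverViaE (premTM o toCutRTM (ilRTM s)) (coverSome q) l in (someRes p , r₂) , covSub (⊑-++ʳ _) c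

keptFromCov : ∀ {Δ} {Λ : Linkings Δ} {L : LinkSet Δ} {v} → Λ L → LeafLinks L → CovBy L v → Kept Λ v
keptFromCov {L = L} m lf (e , y , li , le) = L , m , e , y , li , leafLinkIn lf li , le

keptRoot : ∀ {Δ} (Π : Proof Δ) (j : Occ Δ) → Kept (θ Π) (rootV j)
keptRoot Π j = let (R , c) = coverSome Π j in keptFromCov (R , refl) (leaves Π R) c

-- If a link lies in λ_R but not in λ_R′, then some &-vertex is
-- toggled by {λ_R, λ_R′}: follow the proof down to an &-rule where R and
-- R′ choose different branches.  Toggling is transported along premise
-- embeddings, which is how the &-vertex found in a premise reappears in
-- the conclusion.

keptMap : ∀ {Δ Δ′} {F : Vtx Δ → Vtx Δ′} {L₁ L₂ : LinkSet Δ} {M₁ M₂ : LinkSet Δ′} → TreeMap F →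
  map (mapLink F) L₁ ⊑ M₁ → map (mapLink F) L₂ ⊑ M₂ →
  ∀ {l} → Kept (Pair L₁ L₂) l → Kept (Pair M₁ M₂) (F l)
keptMap {F = F} {M₁ = M₁} tF s₁ s₂ (_ , inj₁ refl , e , y , li , lf , le) =
  M₁ , inj₁ refl , F e , F y , s₁ (LinkInMap F li) , trans (node-pres tF e) lf , ≼-pres tF le
keptMap {F = F} {M₂ = M₂} tF s₁ s₂ (_ , inj₂ refl , e , y , li , lf , le) =
  M₂ , inj₂ refl , F e , F y , s₂ (LinkInMap F li) , trans (node-pres tF e) lf , ≼-pres tF le

togMap : ∀ {Δ Δ′} {F : Vtx Δ → Vtx Δ′} {L₁ L₂ : LinkSet Δ} {M₁ M₂ : LinkSet Δ′} → TreeMap F →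
  map (mapLink F) L₁ ⊑ M₁ → map (mapLink F) L₂ ⊑ M₂ →
  ∀ {w} → Toggled (Pair L₁ L₂) w → Toggled (Pair M₁ M₂) (F w)
togMap {F = F} tF s₁ s₂ {w} (nw , (l , c , k) , (r , c′ , k′)) =
  trans (node-pres tF w) nw , (F l , child-pres tF c , keptMap tF s₁ s₂ k) , (F r , child-pres tF c′ , keptMap tF s₁ s₂ k′)

SomeToggled : ∀ {Δ} → LinkSet Δ → LinkSet Δ → Set
SomeToggled {Δ} L₁ L₂ = Σ (Vtx Δ) (Toggled (Pair L₁ L₂))

Differ⇒Toggled : ∀ {Δ} → LinkSet Δ → LinkSet Δ → Set
Differ⇒Toggled L₁ L₂ = ∀ {u v} → LinkIn (u , v) L₁ → ¬ LinkIn (u , v) L₂ → SomeToggled L₁ L₂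

differMap : ∀ {Δ Δ′} {F : Vtx Δ → Vtx Δ′} (tF : TreeMap F) (L₁ L₂ : LinkSet Δ) {M₁ M₂ : LinkSet Δ′} →
  map (mapLink F) L₁ ⊑ M₁ → map (mapLink F) L₂ ⊑ M₂ → Differ⇒Toggled L₁ L₂ →
  ∀ {u v} → LinkIn (u , v) (map (mapLink F) L₁) → ¬ LinkIn (u , v) M₂ → SomeToggled M₁ M₂
differMap {F = F} tF L₁ L₂ s₁ s₂ ih li nl with LinkInMap⁻ F L₁ li
... | c , d , li′ , refl , refl =
  let (w , t) = ih li′ (λ h → nl (s₂ (LinkInMap F h))) in F w , togMap tF s₁ s₂ t

toggled& : ∀ {A B Γ Δ Γ₁ Γ₂} (o : Ins (frm (bin wth A B)) Γ Δ) (s : Split3 Γ₁ Γ₂ Γ)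
  (p : Proof (frm A ∷ Γ₁)) (q : Proof (frm B ∷ Γ₂)) r r′ {Λ : Linkings Δ} →
  Λ (links (&-r o s p q) (inj₁ r)) → Λ (links (&-r o s p q) (inj₂ r′)) → Toggled Λ (insP o (frmP here))
toggled& o s p q r r′ mL mR =
  nodeI-pres (insPTM o) (frmP here) ,
  (insP o (frmP (left here)) , childI-pres (insPTM o) (frmC cl) ,
     keptFromCov mL (leafMap tL (leaves p r)) (covMap tL (reflV _) (cover p r first λ ()))) ,
  (insP o (frmP (right here)) , childI-pres (insPTM o) (frmC cr) ,
     keptFromCov mR (leafMap tR (leaves q r′)) (covMap tR (reflV _) (cover q r′ first λ ())))
  where
  tL = premTM o inLeftTM (s3LTM s)
  tR = premTM o inRightTM (s3RTM s)

diff : ∀ {Δ} (Π : Proof Δ) R R′ → Differ⇒Toggled (links Π R) (links Π R′)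
diff (ax⁺ n) _ _ li nl = ⊥-elim (nl li)
diff (ax⁻ n) _ _ li nl = ⊥-elim (nl li)
diff (⊗-r o s p q) (r₁ , r₂) (r₁′ , r₂′) li nl with LinkIn++⁻ _ li
... | inj₁ l = differMap (premTM o inLeftTM (ilLTM s)) (links p r₁) (links p r₁′) ⊑-++ˡ ⊑-++ˡ (diff p r₁ r₁′) l nl
... | inj₂ l = differMap (premTM o inRightTM (ilRTM s)) (links q r₂) (links q r₂′) (⊑-++ʳ _) (⊑-++ʳ _) (diff q r₂ r₂′) l nl
diff (cut-r o s p q) (r₁ , r₂) (r₁′ , r₂′) li nl with LinkIn++⁻ _ li
... | inj₁ l = differMap (premTM o toCutLTM (ilLTM s)) (links p r₁) (links p r₁′) ⊑-++ˡ ⊑-++ˡ (diff p r₁ r₁′) l nl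
... | inj₂ l = differMap (premTM o toCutRTM (ilRTM s)) (links q r₂) (links q r₂′) (⊑-++ʳ _) (⊑-++ʳ _) (diff q r₂ r₂′) l nl
diff (⅋-r o p) r r′ = differMap (parTM o) (links p r) (links p r′) (λ h → h) (λ h → h) (diff p r r′)
diff (⊕₁-r o p) r r′ = differMap (premTM o inLeftTM idTM) (links p r) (links p r′) (λ h → h) (λ h → h) (diff p r r′)
diff (⊕₂-r o p) r r′ = differMap (premTM o inRightTM idTM) (links p r) (links p r′) (λ h → h) (λ h → h) (diff p r r′)
diff (&-r o s p q) (inj₁ r) (inj₁ r′) =
  differMap (premTM o inLeftTM (s3LTM s)) (links p r) (links p r′) (λ h → h) (λ h → h) (diff p r r′)
diff (&-r o s p q) (inj₂ r) (inj₂ r′) =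
  differMap (premTM o inRightTM (s3RTM s)) (links q r) (links q r′) (λ h → h) (λ h → h) (diff q r r′)
diff (&-r o s p q) (inj₁ r) (inj₂ r′) _ _ = insP o (frmP here) , toggled& o s p q r r′ (inj₁ refl) (inj₂ refl)
diff (&-r o s p q) (inj₂ r) (inj₁ r′) _ _ = insP o (frmP here) , toggled& o s p q r′ r (inj₂ refl) (inj₁ refl)

Sim : ∀ {Δ} → Linkings Δ → Linkings Δ → Set
Sim {Δ} Λ Λ′ = ∀ {L} → Λ L → Σ (LinkSet Δ) λ M → Λ′ M × L ⊑ M × M ⊑ L

keptSim : ∀ {Δ} {Λ Λ′ : Linkings Δ} → Sim Λ Λ′ → ∀ {v} → Kept Λ v → Kept Λ′ v
keptSim sim (L , m , e , y , li , lf , le) = let (M , m′ , f , _) = sim m in M , m′ , e , y , f li , lf , le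

toggledSim : ∀ {Δ} {Λ Λ′ : Linkings Δ} → Sim Λ Λ′ → ∀ {w} → Toggled Λ w → Toggled Λ′ w
toggledSim sim (nw , (l , c , k) , (r , c′ , k′)) = nw , (l , c , keptSim sim k) , (r , c′ , keptSim sim k′)

pairSim : ∀ {Δ} {L₁ L₂ M₁ M₂ : LinkSet Δ} → L₁ ⊑ M₁ → M₁ ⊑ L₁ → L₂ ⊑ M₂ → M₂ ⊑ L₂ →
  Sim (Pair L₁ L₂) (Pair M₁ M₂)
pairSim f₁ b₁ f₂ b₂ (inj₁ refl) = _ , inj₁ refl , f₁ , b₁
pairSim f₁ b₁ f₂ b₂ (inj₂ refl) = _ , inj₂ refl , f₂ , b₂

dependsSim : ∀ {Δ} {Λ Λ′ : Linkings Δ} → Sim Λ Λ′ → ∀ {a w} → Depends Λ a w → Depends Λ′ a w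
dependsSim sim (L₁ , L₂ , m₁ , m₂ , li , nli , tog , uniq) =
  let (M₁ , m₁′ , f₁ , b₁) = sim m₁ ; (M₂ , m₂′ , f₂ , b₂) = sim m₂ in
  M₁ , M₂ , m₁′ , m₂′ , f₁ li , (λ h → nli (b₂ h)) , toggledSim (pairSim f₁ b₁ f₂ b₂) tog ,
  (λ w′ t → uniq w′ (toggledSim (pairSim b₁ f₁ b₂ f₂) t))

LinkOrJump : ∀ {Δ} → Linkings Δ → Vtx Δ → Vtx Δ → Set
LinkOrJump {Δ} Λ u v = (Σ (LinkSet Δ) λ L → Λ L × LinkIn (u , v) L) ⊎ (Σ (Vtx Δ) λ y → Depends Λ (u , y) v)

linkOrJumpSim : ∀ {Δ} {Λ Λ′ : Linkings Δ} → Sim Λ Λ′ → ∀ {u w} → LinkOrJump Λ u w → LinkOrJump Λ′ u w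
linkOrJumpSim sim (inj₁ (L , m , li)) = let (M , m′ , f , _) = sim m in inj₁ (M , m′ , f li)
linkOrJumpSim sim (inj₂ (y , d))      = inj₂ (y , dependsSim sim d)

NetInto : ∀ {Δ} → Proof Δ → Proof Δ → Set
NetInto Π Π′ = ∀ R → Σ (Res Π′) (λ R′ → links Π R ≈L links Π′ R′)

netSim : ∀ {Δ} (Π Π′ : Proof Δ) → NetInto Π Π′ → Sim (θ Π) (θ Π′)
netSim Π Π′ into (R , refl) =
  let (R′ , eqv) = into R in links Π′ R′ , (R′ , refl) , (λ {a} h → proj₁ (eqv a) h) , (λ {a} h → proj₂ (eqv a) h)

≈L-sym : ∀ {Δ} {L M : LinkSet Δ} → L ≈L M → M ≈L L
≈L-sym e a = proj₂ (e a) , proj₁ (e a)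

netBack : ∀ {Δ} (Π Π′ : Proof Δ) → SameNet Π Π′ → NetInto Π′ Π
netBack Π Π′ (_ , back) R′ = let (R , e) = back R′ in R , ≈L-sym e

viewIns : ∀ {x Γ Δ} → Ins x Γ Δ → Vtx Δ → IPos x ⊎ Vtx Γ
viewIns ins-here      (at p)   = inj₁ p
viewIns ins-here      (skip v) = inj₂ v
viewIns (ins-there o) (at p)   = inj₂ (at p)
viewIns (ins-there o) (skip v) = map₂ skip (viewIns o v)

viewIns-insP : ∀ {x Γ Δ} (o : Ins x Γ Δ) p → viewIns o (insP o p) ≡ inj₁ p
viewIns-insP ins-here      p = refl
viewIns-insP (ins-there o) p = cong (map₂ skip) (viewIns-insP o p)

viewIns-insV : ∀ {x Γ Δ} (o : Ins x Γ Δ) v → viewIns o (insV o v) ≡ inj₂ v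
viewIns-insV ins-here      v        = refl
viewIns-insV (ins-there o) (at p)   = refl
viewIns-insV (ins-there o) (skip v) = cong (map₂ skip) (viewIns-insV o v)

viewChild : ∀ {x Γ Δ} (o : Ins x Γ Δ) {d u w} → ChildV d u w →
  Σ (IPos x) (λ p → Σ (IPos x) λ q → viewIns o u ≡ inj₁ p × viewIns o w ≡ inj₁ q × ChildI d p q) ⊎
  Σ (Vtx Γ) (λ v → Σ (Vtx Γ) λ v′ → viewIns o u ≡ inj₂ v × viewIns o w ≡ inj₂ v′ × ChildV d v v′)
viewChild ins-here      (atC c)   = inj₁ (_ , _ , refl , refl , c)
viewChild ins-here      (skipC c) = inj₂ (_ , _ , refl , refl , c)
viewChild (ins-there o) (atC c)   = inj₂ (_ , _ , refl , refl , atC c)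
viewChild (ins-there o) (skipC c) with viewChild o c
... | inj₁ (p , q , e₁ , e₂ , c′) = inj₁ (p , q , cong (map₂ skip) e₁ , cong (map₂ skip) e₂ , c′)
... | inj₂ (v , v′ , e₁ , e₂ , c′) = inj₂ (skip v , skip v′ , cong (map₂ skip) e₁ , cong (map₂ skip) e₂ , skipC c′)

data Side : Set where
  sideL sideR sideT : Side

headSide : ∀ {x} → IPos x → Side
headSide (frmP here)      = sideT
headSide (frmP (left _))  = sideL
headSide (frmP (right _)) = sideR
headSide cutRoot          = sideT
headSide (cutL _)         = sideL
headSide (cutR _)         = sideR

ctxSide : ∀ {Γ₁ Γ₂ Γ} → Interleaving Γ₁ Γ₂ Γ → Vtx Γ → Side
ctxSide (consˡ s) (at _)   = sideL
ctxSide (consˡ s) (skip v) = ctxSide s v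
ctxSide (consʳ s) (at _)   = sideR
ctxSide (consʳ s) (skip v) = ctxSide s v

ctxSide-ilL : ∀ {Γ₁ Γ₂ Γ} (s : Interleaving Γ₁ Γ₂ Γ) v → ctxSide s (ilL s v) ≡ sideL
ctxSide-ilL (consˡ s) (at p)   = refl
ctxSide-ilL (consˡ s) (skip v) = ctxSide-ilL s v
ctxSide-ilL (consʳ s) v        = ctxSide-ilL s v

ctxSide-ilR : ∀ {Γ₁ Γ₂ Γ} (s : Interleaving Γ₁ Γ₂ Γ) v → ctxSide s (ilR s v) ≡ sideR
ctxSide-ilR (consʳ s) (at p)   = refl
ctxSide-ilR (consʳ s) (skip v) = ctxSide-ilR s v
ctxSide-ilR (consˡ s) v        = ctxSide-ilR s v

ctxSide-child : ∀ {Γ₁ Γ₂ Γ} (s : Interleaving Γ₁ Γ₂ Γ) {d v v′} → ChildV d v v′ → ctxSide s v ≡ ctxSide s v′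
ctxSide-child (consˡ s) (atC c)   = refl
ctxSide-child (consˡ s) (skipC c) = ctxSide-child s c
ctxSide-child (consʳ s) (atC c)   = refl
ctxSide-child (consʳ s) (skipC c) = ctxSide-child s c

sideOf : ∀ {x Γ Δ} → Ins x Γ Δ → (Vtx Γ → Side) → Vtx Δ → Side
sideOf o f u = [ headSide , f ]′ (viewIns o u)

record ActiveEmb {A x} (h : IPos (frm A) → IPos x) (σ : Side) : Set where
  field
    treeMap : TreeMapII h
    onSide  : ∀ i → headSide (h i) ≡ σ
open ActiveEmb

inLeftA : ∀ {c A B} → ActiveEmb (inLeft {c} {A} {B}) sideL
inLeftA = record { treeMap = inLeftTM ; onSide = λ { (frmP _) → refl } }

inRightA : ∀ {c A B} → ActiveEmb (inRight {c} {A} {B}) sideR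
inRightA = record { treeMap = inRightTM ; onSide = λ { (frmP _) → refl } }

toCutLA : ∀ {A} → ActiveEmb (toCutL {A}) sideL
toCutLA = record { treeMap = toCutLTM ; onSide = λ { (frmP _) → refl } }

toCutRA : ∀ {A} → ActiveEmb (toCutR {A}) sideR
toCutRA = record { treeMap = toCutRTM ; onSide = λ { (frmP _) → refl } }

FromPremises : ∀ {x A B Γ Δ Γ₁ Γ₂} (o : Ins x Γ Δ) (s : Interleaving Γ₁ Γ₂ Γ)
  (hL : IPos (frm A) → IPos x) (hR : IPos (frm B) → IPos x) →
  Proof (frm A ∷ Γ₁) → Proof (frm B ∷ Γ₂) → Linkings Δ → Set
FromPremises o s hL hR p q Λ = ∀ {L} → Λ L → Σ (Res p) λ r₁ → Σ (Res q) λ r₂ →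
  map (mapLink (prem o hL (ilL s))) (links p r₁) ++ map (mapLink (prem o hR (ilR s))) (links q r₂) ≡ L

-- Link and jump edges never change sides: a link comes from one premise,
-- and the unique &-vertex it depends on lies in that same premise (the
-- toggled vertex found by 'diff' inside the premise must be it).
module SideInvariance {x A B Γ Δ Γ₁ Γ₂} (o : Ins x Γ Δ) (s : Interleaving Γ₁ Γ₂ Γ)
  {hL : IPos (frm A) → IPos x} {hR : IPos (frm B) → IPos x} (aL : ActiveEmb hL sideL) (aR : ActiveEmb hR sideR)
  (p : Proof (frm A ∷ Γ₁)) (q : Proof (frm B ∷ Γ₂)) {Λ : Linkings Δ} (fromP : FromPremises o s hL hR p q Λ) where

  F : Vtx (frm A ∷ Γ₁) → Vtx Δ
  F = prem o hL (ilL s)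
  G : Vtx (frm B ∷ Γ₂) → Vtx Δ
  G = prem o hR (ilR s)

  side : Vtx Δ → Side
  side = sideOf o (ctxSide s)

  sideF : ∀ z → side (F z) ≡ sideL
  sideF (at i)   = trans (cong [ headSide , ctxSide s ]′ (viewIns-insP o (hL i))) (onSide aL i)
  sideF (skip v) = trans (cong [ headSide , ctxSide s ]′ (viewIns-insV o (ilL s v))) (ctxSide-ilL s v)

  sideG : ∀ z → side (G z) ≡ sideR
  sideG (at i)   = trans (cong [ headSide , ctxSide s ]′ (viewIns-insP o (hR i))) (onSide aR i)
  sideG (skip v) = trans (cong [ headSide , ctxSide s ]′ (viewIns-insV o (ilR s v))) (ctxSide-ilR s v)

  linkSide : ∀ {L L′ u v} → Λ L → Λ L′ → LinkIn (u , v) L →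
    side u ≡ side v × (¬ LinkIn (u , v) L′ → Σ (Vtx Δ) λ w → Toggled (Pair L L′) w × side w ≡ side u)
  linkSide m m′ li with fromP m | fromP m′
  ... | r₁ , r₂ , refl | r₁′ , r₂′ , refl with LinkIn++⁻ (map (mapLink F) (links p r₁)) li
  ...   | inj₁ l with LinkInMap⁻ F (links p r₁) l
  ...     | c , d , l′ , refl , refl =
    trans (sideF c) (sym (sideF d)) ,
    λ nl → let (w , t) = diff p r₁ r₁′ l′ (λ h → nl (⊑-++ˡ (LinkInMap F h)))
           in F w , togMap (premTM o (treeMap aL) (ilLTM s)) ⊑-++ˡ ⊑-++ˡ t , trans (sideF w) (sym (sideF c))
  linkSide m m′ li | r₁ , r₂ , refl | r₁′ , r₂′ , refl | inj₂ l with LinkInMap⁻ G (links q r₂) l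
  ...     | c , d , l′ , refl , refl =
    trans (sideG c) (sym (sideG d)) ,
    λ nl → let (w , t) = diff q r₂ r₂′ l′ (λ h → nl (⊑-++ʳ (map (mapLink F) (links p r₁′)) (LinkInMap G h)))
           in G w , togMap (premTM o (treeMap aR) (ilRTM s)) (⊑-++ʳ _) (⊑-++ʳ _) t , trans (sideG w) (sym (sideG c))

  preserved : ∀ {u w} → LinkOrJump Λ u w → side u ≡ side w
  preserved (inj₁ (L , m , li)) = proj₁ (linkSide m m li)
  preserved (inj₂ (y , L , L′ , m , m′ , li , nli , _ , uniq)) =
    let (w′ , t , e) = proj₂ (linkSide m m′ li) nli in trans (sym e) (cong side (uniq w′ t))

-- Let f, f′ assign sides to the context (constant on
-- each item), such that link/jump edges of Λ preserve the sides given by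
-- f, and those of the equivalent Λ′ preserve the sides given by f′.  Then
-- the context vertices where f and f′ disagree are closed under the edges
-- of G(Λ); since the principal root is not among them, no such vertex is
-- connected to it.
module Walk {x Γ Δ} (o : Ins x Γ Δ) (f f′ : Vtx Γ → Side)
  (cf : ∀ {d v v′} → ChildV d v v′ → f v ≡ f v′) (cf′ : ∀ {d v v′} → ChildV d v v′ → f′ v ≡ f′ v′)
  (Λ Λ′ : Linkings Δ) (sim : Sim Λ Λ′)
  (pres : ∀ {u w} → LinkOrJump Λ u w → sideOf o f u ≡ sideOf o f w)
  (pres′ : ∀ {u w} → LinkOrJump Λ′ u w → sideOf o f′ u ≡ sideOf o f′ w) where

  Disagree : Vtx Δ → Set
  Disagree u = Σ (Vtx Γ) λ v → viewIns o u ≡ inj₂ v × f v ≢ f′ v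

  -- a link/jump edge cannot leave the context, since f, f′ agree on x
  viaLinkOrJump : ∀ {u w} → sideOf o f u ≡ sideOf o f w → sideOf o f′ u ≡ sideOf o f′ w → Disagree u → Disagree w
  viaLinkOrJump {u} {w} e e′ (v , hv , ne) = continue (viewIns o w) refl
    where
    agreeAt : sideOf o f w ≡ sideOf o f′ w → f v ≡ f′ v
    agreeAt eq = trans (cong [ headSide , f ]′ (sym hv)) (trans e (trans eq (trans (sym e′) (cong [ headSide , f′ ]′ hv))))
    continue : ∀ z → viewIns o w ≡ z → Disagree w
    continue (inj₁ p)  ew = ⊥-elim (ne (agreeAt (trans (cong [ headSide , f ]′ ew) (sym (cong [ headSide , f′ ]′ ew)))))
    continue (inj₂ v′) ew = v′ , ew , λ eq →
      ne (agreeAt (trans (cong [ headSide , f ]′ ew) (trans eq (sym (cong [ headSide , f′ ]′ ew)))))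

  -- a tree edge starting in the context stays in the same item
  viaChild : ∀ {d u w} → ChildV d u w ⊎ ChildV d w u → Disagree u → Disagree w
  viaChild (inj₁ c) (v , hv , ne) with viewChild o c
  ... | inj₁ (_ , _ , e₁ , _ , _) with trans (sym e₁) hv
  ...   | ()
  viaChild (inj₁ c) (v , hv , ne) | inj₂ (_ , v′ , e₁ , e₂ , c′) with trans (sym e₁) hv
  ...   | refl = v′ , e₂ , λ eq → ne (trans (cf c′) (trans eq (sym (cf′ c′))))
  viaChild (inj₂ c) (v , hv , ne) with viewChild o c
  ... | inj₁ (_ , _ , _ , e₂ , _) with trans (sym e₂) hv
  ...   | ()
  viaChild (inj₂ c) (v , hv , ne) | inj₂ (v′ , _ , e₁ , e₂ , c′) with trans (sym e₂) hv
  ...   | refl = v′ , e₁ , λ eq → ne (trans (sym (cf c′)) (trans eq (cf′ c′)))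

  step : ∀ {u w} → Adj Λ u w → Disagree u → Disagree w
  step (inj₁ (inj₁ (_ , _ , inj₁ c))) = viaChild (inj₁ c)
  step (inj₁ (inj₁ (_ , _ , inj₂ c))) = viaChild (inj₁ c)
  step (inj₂ (inj₁ (_ , _ , inj₁ c))) = viaChild (inj₂ c)
  step (inj₂ (inj₁ (_ , _ , inj₂ c))) = viaChild (inj₂ c)
  step (inj₁ (inj₂ e)) = viaLinkOrJump (pres e) (pres′ (linkOrJumpSim sim e))
  step (inj₂ (inj₂ e)) = viaLinkOrJump (sym (pres e)) (sym (pres′ (linkOrJumpSim sim e)))

  unreachable : ∀ {u} → Star (Adj Λ) u (insP o (rootI x)) → ¬ Disagree u
  unreachable path d with fold (λ u w → Disagree u → Disagree w) (λ e k → k ∘ step e) (λ d → d) path d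
  ... | _ , hv , _ with trans (sym (viewIns-insP o (rootI x))) hv
  ...   | ()

principalOcc : ∀ {x Γ Δ} (o : Ins x Γ Δ) → Σ (Occ Δ) λ j → rootV j ≡ insP o (rootI x)
principalOcc ins-here      = first , refl
principalOcc (ins-there o) = let (j , e) = principalOcc o in next j , cong skip e

ctxOcc : ∀ {x Γ Δ} (o : Ins x Γ Δ) (j : Occ Γ) → Σ (Occ Δ) λ j′ → rootV j′ ≡ insV o (rootV j)
ctxOcc ins-here      j        = next j , refl
ctxOcc (ins-there o) first    = first , refl
ctxOcc (ins-there o) (next j) = let (j′ , e) = ctxOcc o j in next j′ , cong skip e

keptAt : ∀ {Δ} {Λ : Linkings Δ} → (∀ j → Kept Λ (rootV j)) → ∀ {v} → Σ (Occ Δ) (λ j → rootV j ≡ v) → Kept Λ v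
keptAt kept (j , e) = subst (Kept _) e (kept j)

-- If an item were on different
-- sides in Π and Π′, the walk argument applied to a path from it to the
-- principal root in the connected G(θ_Π) gives a contradiction.

interleavingForced : ∀ {x A B Γ Δ Γ₁ Γ₂ Γ₁′ Γ₂′} (o : Ins x Γ Δ)
  {hL : IPos (frm A) → IPos x} {hR : IPos (frm B) → IPos x} (aL : ActiveEmb hL sideL) (aR : ActiveEmb hR sideR)
  (s : Interleaving Γ₁ Γ₂ Γ) (s′ : Interleaving Γ₁′ Γ₂′ Γ)
  (p : Proof (frm A ∷ Γ₁)) (q : Proof (frm B ∷ Γ₂)) (p′ : Proof (frm A ∷ Γ₁′)) (q′ : Proof (frm B ∷ Γ₂′))
  {Λ Λ′ : Linkings Δ} → FromPremises o s hL hR p q Λ → FromPremises o s′ hL hR p′ q′ Λ′ →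
  Sim Λ Λ′ → Connected Λ → (∀ j → Kept Λ (rootV j)) →
  ∀ j → ¬ (ctxSide s (rootV j) ≢ ctxSide s′ (rootV j))
interleavingForced o aL aR s s′ p q p′ q′ {Λ} {Λ′} fromP fromP′ sim conn kept j ne =
  W.unreachable (conn _ _ (keptAt kept (ctxOcc o j)) (keptAt kept (principalOcc o))) (rootV j , viewIns-insV o (rootV j) , ne)
  where
  module S  = SideInvariance o s  aL aR p  q  fromP
  module S′ = SideInvariance o s′ aL aR p′ q′ fromP′
  module W  = Walk o (ctxSide s) (ctxSide s′) (ctxSide-child s) (ctxSide-child s′) Λ Λ′ sim S.preserved S′.preserved

Interleaved : List Item → Set
Interleaved Γ = Σ (List Item × List Item) λ g → Interleaving (proj₁ g) (proj₂ g) Γ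

interleaving-ext : ∀ {Γ₁ Γ₂ Γ₁′ Γ₂′ Γ} (s : Interleaving Γ₁ Γ₂ Γ) (s′ : Interleaving Γ₁′ Γ₂′ Γ) →
  (∀ j → ¬ (ctxSide s (rootV j) ≢ ctxSide s′ (rootV j))) → _≡_ {A = Interleaved Γ} (_ , s) (_ , s′)
interleaving-ext []        []         _  = refl
interleaving-ext (consˡ s) (consʳ s′) ag = ⊥-elim (ag first λ ())
interleaving-ext (consʳ s) (consˡ s′) ag = ⊥-elim (ag first λ ())
interleaving-ext (consˡ s) (consˡ s′) ag with interleaving-ext s s′ (ag ∘ next)
... | refl = refl
interleaving-ext (consʳ s) (consʳ s′) ag with interleaving-ext s s′ (ag ∘ next)
... | refl = refl

fromPremises⊗ : ∀ {A B Γ Δ Γ₁ Γ₂} {o : Ins (frm (bin tens A B)) Γ Δ} {s : Interleaving Γ₁ Γ₂ Γ} {p q} →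
  FromPremises o s inLeft inRight p q (θ (⊗-r o s p q))
fromPremises⊗ ((r₁ , r₂) , e) = r₁ , r₂ , e

fromPremisesCut : ∀ {A Γ Δ Γ₁ Γ₂} {o : Ins (cut A) Γ Δ} {s : Interleaving Γ₁ Γ₂ Γ} {p q} →
  FromPremises o s toCutL toCutR p q (θ (cut-r o s p q))
fromPremisesCut ((r₁ , r₂) , e) = r₁ , r₂ , e

tensorUnique : ∀ {A B Γ Δ Γ₁ Γ₂ Γ₁′ Γ₂′} (o : Ins (frm (bin tens A B)) Γ Δ)
  (s : Interleaving Γ₁ Γ₂ Γ) (s′ : Interleaving Γ₁′ Γ₂′ Γ) p q p′ q′ →
  SameNet (⊗-r o s p q) (⊗-r o s′ p′ q′) → Connected (θ (⊗-r o s p q)) → i⊗ o s ≡ i⊗ o s′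
tensorUnique o s s′ p q p′ q′ net conn =
  cong (λ t → i⊗ o (proj₂ t)) (interleaving-ext s s′
    (interleavingForced o inLeftA inRightA s s′ p q p′ q′ (fromPremises⊗ {o = o} {s} {p} {q}) (fromPremises⊗ {o = o} {s′} {p′} {q′})
       (netSim (⊗-r o s p q) (⊗-r o s′ p′ q′) (proj₁ net)) conn (keptRoot (⊗-r o s p q))))

cutUnique : ∀ {A Γ Δ Γ₁ Γ₂ Γ₁′ Γ₂′} (o : Ins (cut A) Γ Δ)
  (s : Interleaving Γ₁ Γ₂ Γ) (s′ : Interleaving Γ₁′ Γ₂′ Γ) p q p′ q′ →
  SameNet (cut-r o s p q) (cut-r o s′ p′ q′) → Connected (θ (cut-r o s p q)) → icut o s ≡ icut o s′
cutUnique o s s′ p q p′ q′ net conn =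
  cong (λ t → icut o (proj₂ t)) (interleaving-ext s s′
    (interleavingForced o toCutLA toCutRA s s′ p q p′ q′ (fromPremisesCut {o = o} {s} {p} {q}) (fromPremisesCut {o = o} {s′} {p′} {q′})
       (netSim (cut-r o s p q) (cut-r o s′ p′ q′) (proj₁ net)) conn (keptRoot (cut-r o s p q))))

insP≼⁻ : ∀ {x Γ Δ} (o : Ins x Γ Δ) {p p′} → insP o p ≼V insP o p′ → p ≼I p′
insP≼⁻ ins-here      (at≼ l)   = l
insP≼⁻ (ins-there o) (skip≼ l) = insP≼⁻ o l

insP⋠insV : ∀ {x Γ Δ} (o : Ins x Γ Δ) {p} v → ¬ insP o p ≼V insV o v
insP⋠insV (ins-there o) (skip v) (skip≼ l) = insP⋠insV o v l

insV⋠insP : ∀ {x Γ Δ} (o : Ins x Γ Δ) {p} v → ¬ insV o v ≼V insP o p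
insV⋠insP (ins-there o) (skip v) (skip≼ l) = insV⋠insP o v l

insV≼⁻ : ∀ {x Γ Δ} (o : Ins x Γ Δ) v v′ → insV o v ≼V insV o v′ → v ≼V v′
insV≼⁻ ins-here      v        v′        (skip≼ l) = l
insV≼⁻ (ins-there o) (at p)   (at p′)   (at≼ l)   = at≼ l
insV≼⁻ (ins-there o) (skip v) (skip v′) (skip≼ l) = skip≼ (insV≼⁻ o v v′ l)

-- & and ⊕: which branch a linking comes from is visible in the net.  A
-- linking through the left premise covers the left argument of the
-- principal formula, one through the right premise does not (and
-- symmetrically).

≈L⇒⊑ : ∀ {Δ} {L M : LinkSet Δ} → L ≈L M → L ⊑ M
≈L⇒⊑ e {a} = proj₁ (e a)

leftArgCovered : ∀ {c A B Γ Δ Γ′} (o : Ins (frm (bin c A B)) Γ Δ) {k : Vtx Γ′ → Vtx Γ} → TreeMap k →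
  (p : Proof (frm A ∷ Γ′)) (r : Res p) → CovBy (map (mapLink (prem o inLeft k)) (links p r)) (insP o (frmP (left here)))
leftArgCovered o tk p r = covMap (premTM o inLeftTM tk) (reflV _) (cover p r first λ ())

rightArgCovered : ∀ {c A B Γ Δ Γ′} (o : Ins (frm (bin c A B)) Γ Δ) {k : Vtx Γ′ → Vtx Γ} → TreeMap k →
  (q : Proof (frm B ∷ Γ′)) (r : Res q) → CovBy (map (mapLink (prem o inRight k)) (links q r)) (insP o (frmP (right here)))
rightArgCovered o tk q r = covMap (premTM o inRightTM tk) (reflV _) (cover q r first λ ())

leftArgMissed : ∀ {c A B Γ Δ Γ′} (o : Ins (frm (bin c A B)) Γ Δ) (k : Vtx Γ′ → Vtx Γ) (L : LinkSet (frm B ∷ Γ′)) →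
  ¬ CovBy (map (mapLink (prem o inRight k)) L) (insP o (frmP (left here)))
leftArgMissed o k L (e , y , li , le) with LinkInMap⁻ (prem o inRight k) L li
... | at (frmP q) , _ , _ , refl , _ with insP≼⁻ o le
...   | frm≼ ()
leftArgMissed o k L (e , y , li , le) | skip w , _ , _ , refl , _ = insP⋠insV o (k w) le

rightArgMissed : ∀ {c A B Γ Δ Γ′} (o : Ins (frm (bin c A B)) Γ Δ) (k : Vtx Γ′ → Vtx Γ) (L : LinkSet (frm A ∷ Γ′)) →
  ¬ CovBy (map (mapLink (prem o inLeft k)) L) (insP o (frmP (right here)))
rightArgMissed o k L (e , y , li , le) with LinkInMap⁻ (prem o inLeft k) L li
... | at (frmP q) , _ , _ , refl , _ with insP≼⁻ o le
...   | frm≼ ()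
rightArgMissed o k L (e , y , li , le) | skip w , _ , _ , refl , _ = insP⋠insV o (k w) le

plusMismatch : ∀ {A B Γ Δ} (o : Ins (frm (bin plus A B)) Γ Δ) (p : Proof (frm A ∷ Γ)) (p′ : Proof (frm B ∷ Γ)) →
  ¬ NetInto (⊕₁-r o p) (⊕₂-r o p′)
plusMismatch o p p′ into =
  let (r′ , e) = into (someRes p) in
  leftArgMissed o (λ v → v) (links p′ r′) (covSub (≈L⇒⊑ e) (leftArgCovered o idTM p (someRes p)))

coveredContext : ∀ {x A Γ Δ Γ′} (o : Ins x Γ Δ) (h : IPos (frm A) → IPos x) (k : Vtx Γ′ → Vtx Γ)
  (L : LinkSet (frm A ∷ Γ′)) v → CovBy (map (mapLink (prem o h k)) L) (insV o v) → Σ (Vtx Γ′) λ w → v ≼V k w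
coveredContext o h k L v (e , y , li , le) with LinkInMap⁻ (prem o h k) L li
... | at i    , _ , _ , refl , _ = ⊥-elim (insV⋠insP o v le)
... | skip w , _ , _ , refl , _ = w , insV≼⁻ o v (k w) le

destination-≼ : ∀ {Γ₁ Γ₂ Γ} (s : Split3 Γ₁ Γ₂ Γ) {u v} → u ≼V v → destination s u ≡ destination s v
destination-≼ (onlyL _ s) (at≼ l)   = refl
destination-≼ (onlyR _ s) (at≼ l)   = refl
destination-≼ (both s)    (at≼ l)   = refl
destination-≼ (onlyL _ s) (skip≼ l) = destination-≼ s l
destination-≼ (onlyR _ s) (skip≼ l) = destination-≼ s l
destination-≼ (both s)    (skip≼ l) = destination-≼ s l

goesLeft-s3L : ∀ {Γ₁ Γ₂ Γ} (s : Split3 Γ₁ Γ₂ Γ) w → goesLeft s (s3L s w) ≡ true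
goesLeft-s3L (onlyL _ s) (at p)   = refl
goesLeft-s3L (onlyL _ s) (skip w) = goesLeft-s3L s w
goesLeft-s3L (onlyR _ s) w        = goesLeft-s3L s w
goesLeft-s3L (both s)    (at p)   = refl
goesLeft-s3L (both s)    (skip w) = goesLeft-s3L s w

goesRight-s3R : ∀ {Γ₁ Γ₂ Γ} (s : Split3 Γ₁ Γ₂ Γ) w → goesRight s (s3R s w) ≡ true
goesRight-s3R (onlyR _ s) (at p)   = refl
goesRight-s3R (onlyR _ s) (skip w) = goesRight-s3R s w
goesRight-s3R (onlyL _ s) w        = goesRight-s3R s w
goesRight-s3R (both s)    (at p)   = refl
goesRight-s3R (both s)    (skip w) = goesRight-s3R s w

-- &: if a context item goes to the left premise in Π, it does in Π′: a
-- left-branch linking covering it corresponds to a left-branch linking of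
-- Π′, which covers only the left context of Π′.
module WithRule {A B Γ Δ Γ₁ Γ₂ Γ₁′ Γ₂′} (o : Ins (frm (bin wth A B)) Γ Δ)
  (s : Split3 Γ₁ Γ₂ Γ) (s′ : Split3 Γ₁′ Γ₂′ Γ)
  (p : Proof (frm A ∷ Γ₁)) (q : Proof (frm B ∷ Γ₂)) (p′ : Proof (frm A ∷ Γ₁′)) (q′ : Proof (frm B ∷ Γ₂′))
  (into : NetInto (&-r o s p q) (&-r o s′ p′ q′)) where

  leftPreserved : ∀ j → goesLeft s (rootV j) ≡ true → goesLeft s′ (rootV j) ≡ true
  leftPreserved j h with s3InvL s j h
  ... | j₁ , c₁ with coverSome p (next j₁)
  ...   | r , c with into (inj₁ r)
  ...     | inj₂ r′ , e = ⊥-elim (leftArgMissed o (s3R s′) (links q′ r′)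
                            (covSub (≈L⇒⊑ e) (leftArgCovered o (s3LTM s) p r)))
  ...     | inj₁ r′ , e =
    let covered = covSub (≈L⇒⊑ e) (covMap (premTM o inLeftTM (s3LTM s)) (≡⇒≼ (cong (insV o) (Corr.sameRoot c₁))) c)
        (w , le) = coveredContext o inLeft (s3L s′) (links p′ r′) (rootV j) covered
    in trans (cong proj₁ (destination-≼ s′ le)) (goesLeft-s3L s′ w)

  rightPreserved : ∀ j → goesRight s (rootV j) ≡ true → goesRight s′ (rootV j) ≡ true
  rightPreserved j h with s3InvR s j h
  ... | j₂ , c₂ with coverSome q (next j₂)
  ...   | r , c with into (inj₂ r)
  ...     | inj₁ r′ , e = ⊥-elim (rightArgMissed o (s3L s′) (links p′ r′)
                            (covSub (≈L⇒⊑ e) (rightArgCovered o (s3RTM s) q r)))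
  ...     | inj₂ r′ , e =
    let covered = covSub (≈L⇒⊑ e) (covMap (premTM o inRightTM (s3RTM s)) (≡⇒≼ (cong (insV o) (Corr.sameRoot c₂))) c)
        (w , le) = coveredContext o inRight (s3R s′) (links q′ r′) (rootV j) covered
    in trans (cong proj₂ (destination-≼ s′ le)) (goesRight-s3R s′ w)

Split : List Item → Set
Split Γ = Σ (List Item × List Item) λ g → Split3 (proj₁ g) (proj₂ g) Γ

split-ext : ∀ {Γ₁ Γ₂ Γ₁′ Γ₂′ Γ} (s : Split3 Γ₁ Γ₂ Γ) (s′ : Split3 Γ₁′ Γ₂′ Γ) →
  (∀ j → destination s (rootV j) ≡ destination s′ (rootV j)) → _≡_ {A = Split Γ} (_ , s) (_ , s′)
split-ext [] [] _ = refl
split-ext (onlyL {cut _} _ s) (onlyL {cut _} _ s′) d with split-ext s s′ (d ∘ next)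
... | refl = refl
split-ext (onlyR {cut _} _ s) (onlyR {cut _} _ s′) d with split-ext s s′ (d ∘ next)
... | refl = refl
split-ext (both s) (both s′) d with split-ext s s′ (d ∘ next)
... | refl = refl
split-ext (onlyL {frm _} () _) _ _
split-ext (onlyR {frm _} () _) _ _
split-ext _ (onlyL {frm _} () _) _
split-ext _ (onlyR {frm _} () _) _
split-ext (onlyL {cut _} _ _) (onlyR {cut _} _ _) d with () ← d first
split-ext (onlyL {cut _} _ _) (both _)            d with () ← d first
split-ext (onlyR {cut _} _ _) (onlyL {cut _} _ _) d with () ← d first
split-ext (onlyR {cut _} _ _) (both _)            d with () ← d first
split-ext (both _) (onlyL {cut _} _ _)            d with () ← d first
split-ext (both _) (onlyR {cut _} _ _)            d with () ← d first

withUnique : ∀ {A B Γ Δ Γ₁ Γ₂ Γ₁′ Γ₂′} (o : Ins (frm (bin wth A B)) Γ Δ)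
  (s : Split3 Γ₁ Γ₂ Γ) (s′ : Split3 Γ₁′ Γ₂′ Γ) p q p′ q′ →
  SameNet (&-r o s p q) (&-r o s′ p′ q′) → i& o s ≡ i& o s′
withUnique o s s′ p q p′ q′ net =
  cong (λ t → i& o (proj₂ t)) (split-ext s s′ λ j →
    cong₂ _,_ (⇔→≡ (mk⇔ (W.leftPreserved j) (W′.leftPreserved j)))
              (⇔→≡ (mk⇔ (W.rightPreserved j) (W′.rightPreserved j))))
  where
  module W  = WithRule o s s′ p q p′ q′ (proj₁ net)
  module W′ = WithRule o s′ s p′ q′ p q (netBack (&-r o s p q) (&-r o s′ p′ q′) net)

data Ends {Δ} : ∀ {x Γ} → Ins x Γ Δ → Proof Δ → Set where
  ends⊗   : ∀ {A B Γ Γ₁ Γ₂} {o : Ins (frm (bin tens A B)) Γ Δ} (s : Interleaving Γ₁ Γ₂ Γ) p q → Ends o (⊗-r o s p q)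
  ends⅋   : ∀ {A B Γ} {o : Ins (frm (bin parr A B)) Γ Δ} p → Ends o (⅋-r o p)
  ends&   : ∀ {A B Γ Γ₁ Γ₂} {o : Ins (frm (bin wth A B)) Γ Δ} (s : Split3 Γ₁ Γ₂ Γ) p q → Ends o (&-r o s p q)
  ends⊕₁  : ∀ {A B Γ} {o : Ins (frm (bin plus A B)) Γ Δ} p → Ends o (⊕₁-r o p)
  ends⊕₂  : ∀ {A B Γ} {o : Ins (frm (bin plus A B)) Γ Δ} p → Ends o (⊕₂-r o p)
  endsCut : ∀ {A Γ Γ₁ Γ₂} {o : Ins (cut A) Γ Δ} (s : Interleaving Γ₁ Γ₂ Γ) p q → Ends o (cut-r o s p q)

ends : ∀ {Δ x Γ} {o : Ins x Γ Δ} (Π : Proof Δ) → Generates (lastRule Π) o → Ends o Π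
ends (⊗-r o s p q)   refl = ends⊗ s p q
ends (⅋-r o p)       refl = ends⅋ p
ends (&-r o s p q)   refl = ends& s p q
ends (⊕₁-r o p)      refl = ends⊕₁ p
ends (⊕₂-r o p)      refl = ends⊕₂ p
ends (cut-r o s p q) refl = endsCut s p q

lemma5 : ∀ {Δ : List Item} {x : Item} {Γ : List Item} (o : Ins x Γ Δ)
           (Π Π′ : Proof Δ) →
           SameNet Π Π′ →
           Connected (θ Π) →
           Separates (θ Π) o →
           Generates (lastRule Π) o →
           Generates (lastRule Π′) o →
           lastRule Π ≡ lastRule Π′
lemma5 o Π Π′ net conn _ g g′ with ends Π g | ends Π′ g′
... | ends⊗ s p q   | ends⊗ s′ p′ q′   = tensorUnique o s s′ p q p′ q′ net conn
... | endsCut s p q | endsCut s′ p′ q′ = cutUnique o s s′ p q p′ q′ net conn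
... | ends& s p q   | ends& s′ p′ q′   = withUnique o s s′ p q p′ q′ net
... | ends⅋ _       | ends⅋ _          = refl
... | ends⊕₁ _      | ends⊕₁ _         = refl
... | ends⊕₂ _      | ends⊕₂ _         = refl
... | ends⊕₁ p      | ends⊕₂ p′        = ⊥-elim (plusMismatch o p p′ (proj₁ net))
... | ends⊕₂ p      | ends⊕₁ p′        = ⊥-elim (plusMismatch o p′ p (netBack (⊕₂-r o p) (⊕₁-r o p′) net))
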